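{- Let $p$ be an odd prime and let $\Phi$ be the system of two equations in nine variables $x_1-x_2+x_3-x_4=0$, $x_5-x_6+x_7-x_8+x_9=0$ over $\mathbb{F}_p$. Then $\Phi$ is common: for all $n\ge1$ and all $f:\mathbb{F}_p^n\to[0,1]$, $T_\Phi(f)+T_\Phi(1-f)\ge 2^{ -8}$.
   Context: For a full-rank homogeneous linear system $\Psi$ in $t$ variables with matrix $M_\Psi$ and $f:\mathbb{F}_p^n\to\mathbb{C}$, $T_\Psi(f)=\mathbb{E}_{\mathbf{x}\in(\mathbb{F}_p^n)^t:\,M_\Psi\mathbf{x}=0} f(x_1)\cdots f(x_t)$, where $\mathbb{E}$ is the uniform average over the solution set.
   Formalization: The function f takes rational values in $[0,1]$ rather than real ones. -}

module Defs where

open import Data.Nat as ℕ using (ℕ; zero; suc; NonZero)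
open import Data.Fin using (Fin; toℕ)
open import Data.Fin.Base using () renaming (zero to fz; suc to fs)
open import Data.Vec as Vec using (Vec; []; _∷_; lookup)
open import Data.List as List using (List; []; _∷_; length; filter; map; concatMap; allFin)
open import Data.Integer as ℤ using (ℤ; +_; -[1+_])

open import Data.Rational as ℚ using (ℚ; 0ℚ; 1ℚ; _/_)
open import Relation.Nullary.Decidable using (Dec)
open import Data.Vec.Relation.Unary.All as VAll using ()
import Data.Nat.Properties as ℕP
open import Relation.Binary.PropositionalEquality using (_≡_)

-- F_p is modelled by Fin p (arithmetic mod p via integer representatives);
-- F_p^n is Vec (Fin p) n.

allVecs : {A : Set} → List A → (n : ℕ) → List (Vec A n)
allVecs xs zero = [] ∷ []
allVecs xs (suc n) = concatMap (λ x → map (x ∷_) (allVecs xs n)) xs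

Fpn : (p n : ℕ) → List (Vec (Fin p) n)
Fpn p n = allVecs (allFin p) n

lincomb : {t : ℕ} → Vec ℤ t → Vec ℤ t → ℤ
lincomb [] [] = + 0
lincomb (c ∷ cs) (v ∷ vs) = c ℤ.* v ℤ.+ lincomb cs vs

-- a homogeneous linear system with m equations in t variables,
-- given by its integer coefficient matrix M (rows = equations)
Matrix : (m t : ℕ) → Set
Matrix m t = Vec (Vec ℤ t) m

IsSolution : (p : ℕ) .{{_ : NonZero p}} {n m t : ℕ} →
             Matrix m t → Vec (Vec (Fin p) n) t → Set
IsSolution p {n} M xs =
  VAll.All (λ row → VAll.All
    (λ j → lincomb row (Vec.map (λ x → + toℕ (lookup x j)) xs) ℤ.%ℕ p ≡ 0)
    (Vec.allFin n)) M

isSolution : (p : ℕ) .{{_ : NonZero p}} {n m t : ℕ} →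
             (M : Matrix m t) → (xs : Vec (Vec (Fin p) n) t) → Dec (IsSolution p M xs)
isSolution p {n} M xs =
  VAll.all? (λ row → VAll.all?
    (λ j → lincomb row (Vec.map (λ x → + toℕ (lookup x j)) xs) ℤ.%ℕ p ℕP.≟ 0)
    (Vec.allFin n)) M

solutions : (p : ℕ) .{{_ : NonZero p}} (n : ℕ) {m t : ℕ} →
            Matrix m t → List (Vec (Vec (Fin p) n) t)
solutions p n {t = t} M = filter (isSolution p M) (allVecs (Fpn p n) t)

sumℚ : List ℚ → ℚ
sumℚ = List.foldr ℚ._+_ 0ℚ

prodVec : {t : ℕ} → Vec ℚ t → ℚ
prodVec = Vec.foldr _ ℚ._*_ 1ℚ

-- uniform average over a finite (listed) set; 0 on the empty list
mean : List ℚ → ℚ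
mean [] = 0ℚ
mean (q ∷ qs) = sumℚ (q ∷ qs) ℚ.* ((+ 1) / suc (length qs))

T : (p : ℕ) .{{_ : NonZero p}} (n : ℕ) {m t : ℕ} →
    Matrix m t → (Vec (Fin p) n → ℚ) → ℚ
T p n M f = mean (map (λ xs → prodVec (Vec.map f xs)) (solutions p n M))

Φ : Matrix 2 9
Φ = (+ 1 ∷ -[1+ 0 ] ∷ + 1 ∷ -[1+ 0 ] ∷ + 0 ∷ + 0 ∷ + 0 ∷ + 0 ∷ + 0 ∷ [])
  ∷ (+ 0 ∷ + 0 ∷ + 0 ∷ + 0 ∷ + 1 ∷ -[1+ 0 ] ∷ + 1 ∷ -[1+ 0 ] ∷ + 1 ∷ [])
  ∷ []

{-# OPTIONS --safe #-}

-- The two equations of Φ share no variable, so T_Φ(f) = T₄(f) T₅(f), the averages of f(x₁)⋯f(x₄) and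
-- f(x₅)⋯f(x₉) over the solutions of x₁ − x₂ + x₃ − x₄ = 0 and x₅ − x₆ + x₇ − x₈ + x₉ = 0. Write f = α + h
-- with α = 𝔼 f and 𝔼 h = 0, so that 1 − f = (1 − α) − h, and let R(d) = 𝔼ₐ h(a) h(a + d) and
-- K(y) = 𝔼_d R(d) R(d + y). Then T₄(α + h) = α⁴ + s with s = 𝔼 R² ≥ 0 and T₅(α + h) = α⁵ + e with
-- e = 𝔼 h K, while T₄(−h) = s and T₅(−h) = −e. By Cauchy–Schwarz K ≤ s pointwise, and weighting s − K by
-- f ≥ 0 and by 1 − f ≥ 0 gives e ≤ α s and −e ≤ (1 − α) s. Hence T_Φ(f) + T_Φ(1 − f) equals
-- α⁹ + (1 − α)⁹ + s (α⁵ + (1 − α)⁵) + e (α⁴ − (1 − α)⁴), the last two terms have a nonnegative sum,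
-- and α⁹ + (1 − α)⁹ ≥ 2⁻⁸.

module Submission where

open import Level using (0ℓ)
open import Algebra.Bundles using (AbelianGroup; CommutativeRing; Group)
open import Algebra.Core using (Op₁; Op₂)
open import Algebra.Structures using (IsGroup; IsAbelianGroup)
open import Data.Bool using (true; false; if_then_else_)
open import Data.Fin using (Fin; zero; suc; toℕ; fromℕ<)
import Data.Fin.Properties as Fin
open import Data.Fin.Permutation using (Permutation′; permutation; _⟨$⟩ʳ_)
open import Data.Integer as ℤ using (ℤ; +_; 0ℤ)
import Data.Integer.Properties as ℤ
open import Data.Integer.DivMod using (n%ℕd<d; a≡a%ℕn+[a/ℕn]*n)
open import Data.Integer.Divisibility.Signed using (_∣_; divides; ∣m⇒∣-m; ∣m∣n⇒∣m+n; ∣⇒∣ᵤ)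
open import Data.Integer.Solver using (module +-*-Solver)
open import Data.Integer.Tactic.RingSolver using () renaming (ring to ℤ-ring)
open import Data.List as List using (List; []; _∷_; _++_; map; concatMap; filter; allFin)
open import Data.List.Properties using (map-∘; map-tabulate; length-map)
open import Data.Nat as ℕ using (ℕ; zero; suc; _≥_; NonZero)
import Data.Nat.Coprimality as Coprime
open import Data.Nat.DivMod using (m<n⇒m%n≡m)
open import Data.Nat.Divisibility using (n∣m⇒m%n≡0)
open import Data.Nat.Primality using (Prime)
import Data.Nat.Properties as ℕ
open import Data.Product using (_×_; _,_; proj₁; proj₂)
open import Data.Rational
  using (ℚ; mkℚ; 0ℚ; 1ℚ; ½; _+_; _*_; -_; _-_; _≤_; _/_; 1/_; Positive; positive; nonNegative; nonPositive)
import Data.Rational.Properties as ℚ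
import Algebra.Properties.CommutativeMonoid.Sum ℚ.+-0-commutativeMonoid as Vector
open import Algebra.Properties.Semiring.Exp.TCOptimised (CommutativeRing.semiring ℚ.+-*-commutativeRing)
  using (^-homo-*)
open import Data.Sum using (inj₁; inj₂)
open import Data.Vec as Vec using (Vec; []; _∷_; lookup)
import Data.Vec.Properties as Vec
open import Data.Vec.Relation.Unary.All as VAll using (All)
open import Data.Vec.Relation.Unary.All.Properties using (tabulate⁺; tabulate⁻)
open import Function using (id; _∘_; _$_)
open import Function.Bundles using (_⇔_; mk⇔; Equivalence)
open import Function.Construct.Composition using (_⇔-∘_)
open import Relation.Binary.Definitions using (DecidableEquality)
open import Relation.Binary.PropositionalEquality
open import Relation.Nullary using (Dec; does; yes; no; contradiction)
open import Relation.Nullary.Decidable using (dec⇒maybe; _×-dec_)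
open import Relation.Unary using (Decidable)
open import Tactic.RingSolver using (solve-∀)
open import Tactic.RingSolver.Core.AlmostCommutativeRing using (AlmostCommutativeRing; fromCommutativeRing)

open import Defs
open ≡-Reasoning

-- Rational inequalities

ℚ-ring : AlmostCommutativeRing 0ℓ 0ℓ
ℚ-ring = fromCommutativeRing ℚ.+-*-commutativeRing (λ x → dec⇒maybe (0ℚ ℚ.≟ x))

-- The solver only normalises its own _^_.
open AlmostCommutativeRing ℚ-ring using (_^_)

*-nonNeg : ∀ {p q} → 0ℚ ≤ p → 0ℚ ≤ q → 0ℚ ≤ p * q
*-nonNeg {p} {q} 0≤p 0≤q = ℚ.nonNegative⁻¹ (p * q)
  {{ℚ.nonNeg*nonNeg⇒nonNeg p {{nonNegative 0≤p}} q {{nonNegative 0≤q}}}}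

square-nonNeg : ∀ p → 0ℚ ≤ p * p
square-nonNeg p with ℚ.≤-total 0ℚ p
... | inj₁ 0≤p = *-nonNeg 0≤p 0≤p
... | inj₂ p≤0 = ℚ.nonNegative⁻¹ (p * p)
  {{ℚ.nonPos*nonPos⇒nonPos p {{nonPositive p≤0}} p {{nonPositive p≤0}}}}

p≤q⇒0≤q-p : ∀ {p q} → p ≤ q → 0ℚ ≤ q - p
p≤q⇒0≤q-p {p} {q} p≤q = subst (_≤ q - p) (ℚ.+-inverseʳ p) (ℚ.+-monoˡ-≤ (- p) p≤q)

0≤q-p⇒p≤q : ∀ {p q} → 0ℚ ≤ q - p → p ≤ q
0≤q-p⇒p≤q {p} {q} 0≤q-p = subst₂ _≤_ (ℚ.+-identityʳ p) (p+[q-p]≡q p q) (ℚ.+-monoʳ-≤ p 0≤q-p)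
  where
  p+[q-p]≡q : ∀ p q → p + (q - p) ≡ q
  p+[q-p]≡q = solve-∀ ℚ-ring

-- With v = 2α − 1: 256 (α⁹ + (1 − α)⁹) = 1 + 36 v² + 126 v⁴ + 84 v⁶ + 9 v⁸.
ninth-powers-bound : ∀ α → + 1 / 256 ≤ α ^ 9 + (1ℚ - α) ^ 9
ninth-powers-bound α =
  0≤q-p⇒p≤q (subst (0ℚ ≤_) (sym (expansion α)) (*-nonNeg (0≤m/n 1 {256}) sum-of-squares))
  where
  0≤m/n : ∀ m {n} .{{_ : NonZero n}} → 0ℚ ≤ + m / n
  0≤m/n m {n} = ℚ.nonNegative⁻¹ (+ m / n) {{ℚ.normalize-nonNeg m n}}

  v = α + α - 1ℚ

  expansion : ∀ α → α ^ 9 + (1ℚ - α) ^ 9 - + 1 / 256 ≡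
    + 1 / 256 * (+ 36 / 1 * ((α + α - 1ℚ) * (α + α - 1ℚ))
               + + 126 / 1 * ((α + α - 1ℚ) ^ 2 * (α + α - 1ℚ) ^ 2)
               + + 84 / 1 * ((α + α - 1ℚ) ^ 3 * (α + α - 1ℚ) ^ 3)
               + + 9 / 1 * ((α + α - 1ℚ) ^ 4 * (α + α - 1ℚ) ^ 4))
  expansion = solve-∀ ℚ-ring

  sum-of-squares : 0ℚ ≤ + 36 / 1 * (v * v) + + 126 / 1 * (v ^ 2 * v ^ 2)
                      + + 84 / 1 * (v ^ 3 * v ^ 3) + + 9 / 1 * (v ^ 4 * v ^ 4)
  sum-of-squares = ℚ.+-mono-≤ (ℚ.+-mono-≤ (ℚ.+-mono-≤
    (*-nonNeg (0≤m/n 36 {1}) (square-nonNeg v)) (*-nonNeg (0≤m/n 126 {1}) (square-nonNeg (v ^ 2))))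
    (*-nonNeg (0≤m/n 84 {1}) (square-nonNeg (v ^ 3)))) (*-nonNeg (0≤m/n 9 {1}) (square-nonNeg (v ^ 4)))

fourth-powers-mono : ∀ {x y} → 0ℚ ≤ y → y ≤ x → 0ℚ ≤ x ^ 4 - y ^ 4
fourth-powers-mono {x} {y} 0≤y y≤x = subst (0ℚ ≤_) (factorise x y)
  (*-nonNeg (*-nonNeg (p≤q⇒0≤q-p y≤x) (ℚ.+-mono-≤ (ℚ.≤-trans 0≤y y≤x) 0≤y))
            (ℚ.+-mono-≤ (square-nonNeg x) (square-nonNeg y)))
  where
  factorise : ∀ x y → (x - y) * (x + y) * (x * x + y * y) ≡ x ^ 4 - y ^ 4
  factorise = solve-∀ ℚ-ring

correction-nonNeg : ∀ {α β s e} → 0ℚ ≤ α → 0ℚ ≤ β → 0ℚ ≤ s →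
                    0ℚ ≤ α * s - e → 0ℚ ≤ β * s + e →
                    0ℚ ≤ s * (α ^ 5 + β ^ 5) + e * (α ^ 4 - β ^ 4)
correction-nonNeg {α} {β} {s} {e} 0≤α 0≤β 0≤s 0≤αs-e 0≤βs+e with ℚ.≤-total α β
... | inj₁ α≤β = subst (0ℚ ≤_) (sym (split α β s e))
  (ℚ.+-mono-≤ (*-nonNeg 0≤s (ℚ.+-mono-≤ (*-nonNeg (square-nonNeg (β * β)) (p≤q⇒0≤q-p α≤β))
                                        (*-nonNeg (ℚ.+-mono-≤ 0≤α 0≤α) (square-nonNeg (α * α)))))
              (*-nonNeg 0≤αs-e (fourth-powers-mono 0≤α α≤β)))
  where
  split : ∀ α β s e → s * (α ^ 5 + β ^ 5) + e * (α ^ 4 - β ^ 4) ≡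
    s * ((β * β) * (β * β) * (β - α) + (α + α) * ((α * α) * (α * α))) + (α * s - e) * (β ^ 4 - α ^ 4)
  split = solve-∀ ℚ-ring
... | inj₂ β≤α = subst (0ℚ ≤_) (sym (split α β s e))
  (ℚ.+-mono-≤ (*-nonNeg 0≤s (ℚ.+-mono-≤ (*-nonNeg (square-nonNeg (α * α)) (p≤q⇒0≤q-p β≤α))
                                        (*-nonNeg (ℚ.+-mono-≤ 0≤β 0≤β) (square-nonNeg (β * β)))))
              (*-nonNeg 0≤βs+e (fourth-powers-mono 0≤β β≤α)))
  where
  split : ∀ α β s e → s * (α ^ 5 + β ^ 5) + e * (α ^ 4 - β ^ 4) ≡
    s * ((α * α) * (α * α) * (α - β) + (β + β) * ((β * β) * (β * β))) + (β * s + e) * (α ^ 4 - β ^ 4)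
  split = solve-∀ ℚ-ring

complement-bound : ∀ {α s e} → 0ℚ ≤ α → 0ℚ ≤ 1ℚ - α → 0ℚ ≤ s →
                   0ℚ ≤ α * s - e → 0ℚ ≤ (1ℚ - α) * s + e →
                   + 1 / 256 ≤ (α ^ 4 + s) * (α ^ 5 + e) + ((1ℚ - α) ^ 4 + s) * ((1ℚ - α) ^ 5 - e)
complement-bound {α} {s} {e} 0≤α 0≤1-α 0≤s 0≤αs-e 0≤[1-α]s+e = ℚ.≤-trans (ninth-powers-bound α)
  (0≤q-p⇒p≤q (subst (0ℚ ≤_) (sym (split α (1ℚ - α) s e))
    (correction-nonNeg 0≤α 0≤1-α 0≤s 0≤αs-e 0≤[1-α]s+e)))
  where
  split : ∀ α β s e → (α ^ 4 + s) * (α ^ 5 + e) + (β ^ 4 + s) * (β ^ 5 - e) - (α ^ 9 + β ^ 9) ≡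
    s * (α ^ 5 + β ^ 5) + e * (α ^ 4 - β ^ 4)
  split = solve-∀ ℚ-ring

-- Finite sums

∑ : {A : Set} → List A → (A → ℚ) → ℚ
∑ xs F = sumℚ (map F xs)

syntax ∑ xs (λ x → e) = ∑[ x ∈ xs ] e

𝟙 : {P : Set} → Dec P → ℚ
𝟙 P? = if does P? then 1ℚ else 0ℚ

module _ {A : Set} where

  ∑-cong : ∀ xs {F G : A → ℚ} → (∀ x → F x ≡ G x) → ∑ xs F ≡ ∑ xs G
  ∑-cong []       F≗G = refl
  ∑-cong (x ∷ xs) F≗G = cong₂ _+_ (F≗G x) (∑-cong xs F≗G)

  ∑-zero : ∀ (xs : List A) → ∑[ _ ∈ xs ] 0ℚ ≡ 0ℚ
  ∑-zero []       = refl
  ∑-zero (x ∷ xs) = trans (ℚ.+-identityˡ _) (∑-zero xs)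

  ∑-distrib-+ : ∀ xs (F G : A → ℚ) → ∑[ x ∈ xs ] (F x + G x) ≡ ∑ xs F + ∑ xs G
  ∑-distrib-+ []       F G = refl
  ∑-distrib-+ (x ∷ xs) F G =
    trans (cong (_+_ (F x + G x)) (∑-distrib-+ xs F G)) (interchange (F x) (G x) (∑ xs F) (∑ xs G))
    where
    interchange : ∀ a b c d → a + b + (c + d) ≡ a + c + (b + d)
    interchange = solve-∀ ℚ-ring

  ∑-*ˡ : ∀ xs c (F : A → ℚ) → ∑[ x ∈ xs ] (c * F x) ≡ c * ∑ xs F
  ∑-*ˡ []       c F = sym (ℚ.*-zeroʳ c)
  ∑-*ˡ (x ∷ xs) c F = trans (cong (_+_ (c * F x)) (∑-*ˡ xs c F)) (sym (ℚ.*-distribˡ-+ c (F x) _))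

  ∑-nonNeg : ∀ xs {F : A → ℚ} → (∀ x → 0ℚ ≤ F x) → 0ℚ ≤ ∑ xs F
  ∑-nonNeg []       0≤F = ℚ.≤-refl
  ∑-nonNeg (x ∷ xs) 0≤F = ℚ.+-mono-≤ (0≤F x) (∑-nonNeg xs 0≤F)

  ∑-++ : ∀ xs ys (F : A → ℚ) → ∑ (xs ++ ys) F ≡ ∑ xs F + ∑ ys F
  ∑-++ []       ys F = sym (ℚ.+-identityˡ _)
  ∑-++ (x ∷ xs) ys F = trans (cong (_+_ (F x)) (∑-++ xs ys F)) (sym (ℚ.+-assoc (F x) _ _))

  ∑-filter : ∀ xs {P : A → Set} (P? : Decidable P) (F : A → ℚ) →
             ∑ (filter P? xs) F ≡ ∑[ x ∈ xs ] (𝟙 (P? x) * F x)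
  ∑-filter []       P? F = refl
  ∑-filter (x ∷ xs) P? F with P? x
  ... | yes _ = cong₂ _+_ (sym (ℚ.*-identityˡ (F x))) (∑-filter xs P? F)
  ... | no  _ = trans (∑-filter xs P? F) (sym (trans (cong (_+ _) (ℚ.*-zeroˡ (F x))) (ℚ.+-identityˡ _)))

module _ {A B : Set} where

  ∑-map : ∀ xs (g : A → B) (F : B → ℚ) → ∑ (map g xs) F ≡ ∑[ x ∈ xs ] F (g x)
  ∑-map xs g F = cong sumℚ (sym (map-∘ xs))

  ∑-concatMap : ∀ xs (g : A → List B) (F : B → ℚ) → ∑ (concatMap g xs) F ≡ ∑[ x ∈ xs ] ∑ (g x) F
  ∑-concatMap []       g F = refl
  ∑-concatMap (x ∷ xs) g F = trans (∑-++ (g x) (concatMap g xs) F) (cong (_+_ (∑ (g x) F)) (∑-concatMap xs g F))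

  ∑-comm : ∀ xs ys (F : A → B → ℚ) → ∑[ x ∈ xs ] ∑[ y ∈ ys ] F x y ≡ ∑[ y ∈ ys ] ∑[ x ∈ xs ] F x y
  ∑-comm []       ys F = sym (∑-zero ys)
  ∑-comm (x ∷ xs) ys F = trans (cong (_+_ (∑ ys (F x))) (∑-comm xs ys F)) (sym (∑-distrib-+ ys (F x) _))

∑-mono-≤ : ∀ {A : Set} (xs : List A) {F G : A → ℚ} → (∀ x → F x ≤ G x) → ∑ xs F ≤ ∑ xs G
∑-mono-≤ []       F≤G = ℚ.≤-refl
∑-mono-≤ (x ∷ xs) F≤G = ℚ.+-mono-≤ (F≤G x) (∑-mono-≤ xs F≤G)

𝟙-×-dec : ∀ {P Q : Set} (P? : Dec P) (Q? : Dec Q) → 𝟙 (P? ×-dec Q?) ≡ 𝟙 P? * 𝟙 Q?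
𝟙-×-dec P? Q? with does P? | does Q?
... | true  | true  = refl
... | true  | false = refl
... | false | true  = refl
... | false | false = refl

𝟙-cong : ∀ {P Q : Set} → P ⇔ Q → (P? : Dec P) (Q? : Dec Q) → 𝟙 P? ≡ 𝟙 Q?
𝟙-cong P⇔Q (yes _) (yes _) = refl
𝟙-cong P⇔Q (yes p) (no ¬q) = contradiction (Equivalence.to P⇔Q p) ¬q
𝟙-cong P⇔Q (no ¬p) (yes q) = contradiction (Equivalence.from P⇔Q q) ¬p
𝟙-cong P⇔Q (no _)  (no _)  = refl

∑-1≡length : ∀ {A : Set} (xs : List A) → ∑[ _ ∈ xs ] 1ℚ ≡ + List.length xs / 1
∑-1≡length []       = refl
∑-1≡length (x ∷ xs) = trans (cong (_+_ 1ℚ) (∑-1≡length xs)) (1+[m/1]≡[1+m]/1 (List.length xs))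
  where
  1+[m/1]≡[1+m]/1 : ∀ m → 1ℚ + + m / 1 ≡ + suc m / 1
  1+[m/1]≡[1+m]/1 m = trans (cong (_+_ 1ℚ) (ℚ.↥p/↧p≡p (mkℚ (+ m) 0 (Coprime.sym (Coprime.1-coprimeTo m)))))
    (ℚ./-cong (cong (ℤ._+_ (+ 1)) (ℤ.*-identityʳ (+ m))) refl)

mean-map : ∀ {A : Set} (F : A → ℚ) xs → mean (map F xs) * ∑[ _ ∈ xs ] 1ℚ ≡ ∑ xs F
mean-map F []       = refl
mean-map F (x ∷ xs) = begin
  ∑ (x ∷ xs) F * (+ 1 / suc (List.length (map F xs))) * ∑[ _ ∈ x ∷ xs ] 1ℚ
    ≡⟨ cong₂ (λ m N → ∑ (x ∷ xs) F * (+ 1 / suc m) * N) (length-map F xs) (∑-1≡length (x ∷ xs)) ⟩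
  ∑ (x ∷ xs) F * (+ 1 / suc (List.length xs)) * (+ suc (List.length xs) / 1)
    ≡⟨ ℚ.*-assoc (∑ (x ∷ xs) F) _ _ ⟩
  ∑ (x ∷ xs) F * ((+ 1 / suc (List.length xs)) * (+ suc (List.length xs) / 1))
    ≡⟨ cong (∑ (x ∷ xs) F *_) (1/[1+m]*[1+m]≡1 (List.length xs)) ⟩
  ∑ (x ∷ xs) F * 1ℚ
    ≡⟨ ℚ.*-identityʳ _ ⟩
  ∑ (x ∷ xs) F
    ∎
  where
  1/[1+m]*[1+m]≡1 : ∀ m → (+ 1 / suc m) * (+ suc m / 1) ≡ 1ℚ
  1/[1+m]*[1+m]≡1 m = trans (cong₂ _*_ (ℚ.↥p/↧p≡p (1/ q)) (ℚ.↥p/↧p≡p q)) (ℚ.*-inverseˡ q)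
    where
    q = mkℚ (+ suc m) 0 (Coprime.sym (Coprime.1-coprimeTo (suc m)))

nested : {A : Set} → ((A → ℚ) → ℚ) → (k : ℕ) → (Vec A k → ℚ) → ℚ
nested M zero    F = F []
nested M (suc k) F = M (λ x → nested M k (λ v → F (x ∷ v)))

module _ {A : Set} {M : (A → ℚ) → ℚ} (M-cong : ∀ {F G : A → ℚ} → (∀ x → F x ≡ G x) → M F ≡ M G) where

  nested-cong : ∀ k {F G : Vec A k → ℚ} → (∀ v → F v ≡ G v) → nested M k F ≡ nested M k G
  nested-cong zero    F≗G = F≗G []
  nested-cong (suc k) F≗G = M-cong λ x → nested-cong k (λ v → F≗G (x ∷ v))

  nested-*ˡ : (∀ c (F : A → ℚ) → M (λ x → c * F x) ≡ c * M F) →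
              ∀ k c (F : Vec A k → ℚ) → nested M k (λ v → c * F v) ≡ c * nested M k F
  nested-*ˡ M-*ˡ zero    c F = refl
  nested-*ˡ M-*ˡ (suc k) c F = trans (M-cong λ x → nested-*ˡ M-*ˡ k c (λ v → F (x ∷ v))) (M-*ˡ c _)

  nested-product : (∀ c (F : A → ℚ) → M (λ x → c * F x) ≡ c * M F) →
                   ∀ k m (F : Vec A k → ℚ) (G : Vec A m → ℚ) →
                   nested M k (λ xs → nested M m (λ ys → F xs * G ys)) ≡ nested M k F * nested M m G
  nested-product M-*ˡ k m F G = begin
    nested M k (λ xs → nested M m (λ ys → F xs * G ys))
      ≡⟨ nested-cong k (λ xs → nested-*ˡ M-*ˡ m (F xs) G) ⟩
    nested M k (λ xs → F xs * nested M m G)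
      ≡⟨ nested-cong k (λ xs → ℚ.*-comm (F xs) (nested M m G)) ⟩
    nested M k (λ xs → nested M m G * F xs)
      ≡⟨ nested-*ˡ M-*ˡ k (nested M m G) F ⟩
    nested M m G * nested M k F
      ≡⟨ ℚ.*-comm (nested M m G) (nested M k F) ⟩
    nested M k F * nested M m G
      ∎

  nested-1 : M (λ _ → 1ℚ) ≡ 1ℚ → ∀ k → nested M k (λ _ → 1ℚ) ≡ 1ℚ
  nested-1 M-1 zero    = refl
  nested-1 M-1 (suc k) = trans (M-cong λ _ → nested-1 M-1 k) M-1

∑-allFin-suc : ∀ {m} (F : Fin (suc m) → ℚ) → ∑ (allFin (suc m)) F ≡ F zero + ∑[ i ∈ allFin m ] F (suc i)
∑-allFin-suc {m} F = cong (_+_ (F zero))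
  (trans (cong (λ is → ∑ is F) (sym (map-tabulate id suc))) (∑-map (allFin m) suc F))

∑-allFin≡sum : ∀ {m} (F : Fin m → ℚ) → ∑ (allFin m) F ≡ Vector.sum F
∑-allFin≡sum {zero}  F = refl
∑-allFin≡sum {suc m} F = trans (∑-allFin-suc F) (cong (_+_ (F zero)) (∑-allFin≡sum (F ∘ suc)))

∑-allFin-permute : ∀ {m} (π : Permutation′ m) (F : Fin m → ℚ) →
                   ∑[ i ∈ allFin m ] F (π ⟨$⟩ʳ i) ≡ ∑ (allFin m) F
∑-allFin-permute π F = begin
  ∑[ i ∈ allFin _ ] F (π ⟨$⟩ʳ i)  ≡⟨ ∑-allFin≡sum (F ∘ (π ⟨$⟩ʳ_)) ⟩
  Vector.sum (F ∘ (π ⟨$⟩ʳ_))      ≡⟨ Vector.sum-permute F π ⟨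
  Vector.sum F                    ≡⟨ ∑-allFin≡sum F ⟨
  ∑ (allFin _) F                  ∎

∑-allFin-translate : ∀ {m} {_∙_ : Op₂ (Fin m)} {ε} {_⁻¹ : Op₁ (Fin m)} → IsGroup _≡_ _∙_ ε _⁻¹ →
                     ∀ t (F : Fin m → ℚ) → ∑[ i ∈ allFin m ] F (t ∙ i) ≡ ∑ (allFin m) F
∑-allFin-translate isGroup t F = ∑-allFin-permute translation F
  where
  group : Group 0ℓ 0ℓ
  group = record { isGroup = isGroup }
  open import Algebra.Properties.Group group using (\\-leftDividesˡ; \\-leftDividesʳ)
  translation = permutation _ _ (\\-leftDividesˡ t) (\\-leftDividesʳ t)

∑-allFin-δ : ∀ {m} (t : Fin m) (F : Fin m → ℚ) → ∑[ i ∈ allFin m ] (𝟙 (i Fin.≟ t) * F i) ≡ F t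
∑-allFin-δ {suc m} zero F = begin
  ∑[ i ∈ allFin (suc m) ] (𝟙 (i Fin.≟ zero) * F i)  ≡⟨ ∑-allFin-suc (λ i → 𝟙 (i Fin.≟ zero) * F i) ⟩
  1ℚ * F zero + ∑[ i ∈ allFin m ] (0ℚ * F (suc i))   ≡⟨ cong₂ _+_ (ℚ.*-identityˡ (F zero)) ∑0*F≡0 ⟩
  F zero + 0ℚ                                        ≡⟨ ℚ.+-identityʳ (F zero) ⟩
  F zero                                             ∎
  where
  ∑0*F≡0 = trans (∑-*ˡ (allFin m) 0ℚ (F ∘ suc)) (ℚ.*-zeroˡ (∑ (allFin m) (F ∘ suc)))
∑-allFin-δ {suc m} (suc t) F = begin
  ∑[ i ∈ allFin (suc m) ] (𝟙 (i Fin.≟ suc t) * F i)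
    ≡⟨ ∑-allFin-suc (λ i → 𝟙 (i Fin.≟ suc t) * F i) ⟩
  0ℚ * F zero + ∑[ i ∈ allFin m ] (𝟙 (i Fin.≟ t) * F (suc i))
    ≡⟨ cong₂ _+_ (ℚ.*-zeroˡ (F zero)) (∑-allFin-δ t (F ∘ suc)) ⟩
  0ℚ + F (suc t)
    ≡⟨ ℚ.+-identityˡ (F (suc t)) ⟩
  F (suc t)
    ∎

module _ {A : Set} (xs : List A) where

  ∑-allVecs-suc : ∀ {k} (F : Vec A (suc k) → ℚ) →
                  ∑ (allVecs xs (suc k)) F ≡ ∑[ x ∈ xs ] ∑[ v ∈ allVecs xs k ] F (x ∷ v)
  ∑-allVecs-suc {k} F = trans (∑-concatMap xs _ F) (∑-cong xs λ x → ∑-map (allVecs xs k) (x ∷_) F)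

  ∑-allVecs-translate : ∀ (_∙_ : Op₂ A) → (∀ t (F : A → ℚ) → ∑[ x ∈ xs ] F (t ∙ x) ≡ ∑ xs F) →
                        ∀ {k} t (F : Vec A k → ℚ) →
                        ∑[ v ∈ allVecs xs k ] F (Vec.zipWith _∙_ t v) ≡ ∑ (allVecs xs k) F
  ∑-allVecs-translate _∙_ ∑-translate {zero}  []       F = refl
  ∑-allVecs-translate _∙_ ∑-translate {suc k} (t ∷ ts) F = begin
    ∑[ v ∈ allVecs xs (suc k) ] F (Vec.zipWith _∙_ (t ∷ ts) v)
      ≡⟨ ∑-allVecs-suc _ ⟩
    ∑[ x ∈ xs ] ∑[ v ∈ allVecs xs k ] F ((t ∙ x) ∷ Vec.zipWith _∙_ ts v)
      ≡⟨ ∑-cong xs (λ x → ∑-allVecs-translate _∙_ ∑-translate ts (F ∘ ((t ∙ x) ∷_))) ⟩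
    ∑[ x ∈ xs ] ∑[ v ∈ allVecs xs k ] F ((t ∙ x) ∷ v)
      ≡⟨ ∑-translate t (λ y → ∑[ v ∈ allVecs xs k ] F (y ∷ v)) ⟩
    ∑[ x ∈ xs ] ∑[ v ∈ allVecs xs k ] F (x ∷ v)
      ≡⟨ ∑-allVecs-suc F ⟨
    ∑ (allVecs xs (suc k)) F
      ∎

  ∑-allVecs-δ : ∀ (_≟_ : DecidableEquality A) → (∀ t (F : A → ℚ) → ∑[ x ∈ xs ] (𝟙 (x ≟ t) * F x) ≡ F t) →
                ∀ {k} (t : Vec A k) (F : Vec A k → ℚ) →
                ∑[ v ∈ allVecs xs k ] (𝟙 (Vec.≡-dec _≟_ v t) * F v) ≡ F t
  ∑-allVecs-δ _≟_ ∑-δ {zero}  []       F = trans (ℚ.+-identityʳ _) (ℚ.*-identityˡ (F []))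
  ∑-allVecs-δ _≟_ ∑-δ {suc k} (t ∷ ts) F = begin
    ∑[ v ∈ allVecs xs (suc k) ] (𝟙 (Vec.≡-dec _≟_ v (t ∷ ts)) * F v)
      ≡⟨ ∑-allVecs-suc _ ⟩
    ∑[ x ∈ xs ] ∑[ v ∈ allVecs xs k ] (𝟙 ((x ≟ t) ×-dec Vec.≡-dec _≟_ v ts) * F (x ∷ v))
      ≡⟨ ∑-cong xs (λ x → ∑-cong (allVecs xs k) λ v →
           trans (cong (_* F (x ∷ v)) (𝟙-×-dec (x ≟ t) (Vec.≡-dec _≟_ v ts)))
                 (ℚ.*-assoc (𝟙 (x ≟ t)) (𝟙 (Vec.≡-dec _≟_ v ts)) (F (x ∷ v)))) ⟩
    ∑[ x ∈ xs ] ∑[ v ∈ allVecs xs k ] (𝟙 (x ≟ t) * (𝟙 (Vec.≡-dec _≟_ v ts) * F (x ∷ v)))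
      ≡⟨ ∑-cong xs (λ x →
           trans (∑-*ˡ (allVecs xs k) (𝟙 (x ≟ t)) (λ v → 𝟙 (Vec.≡-dec _≟_ v ts) * F (x ∷ v)))
                 (cong (𝟙 (x ≟ t) *_) (∑-allVecs-δ _≟_ ∑-δ ts (F ∘ (x ∷_))))) ⟩
    ∑[ x ∈ xs ] (𝟙 (x ≟ t) * F (x ∷ ts))
      ≡⟨ ∑-δ t (λ x → F (x ∷ ts)) ⟩
    F (t ∷ ts)
      ∎

∑-allVecs : ∀ {A : Set} (xs : List A) k (F : Vec A k → ℚ) → ∑ (allVecs xs k) F ≡ nested (∑ xs) k F
∑-allVecs xs zero    F = ℚ.+-identityʳ (F [])
∑-allVecs xs (suc k) F = trans (∑-allVecs-suc xs F) (∑-cong xs λ x → ∑-allVecs xs k (λ v → F (x ∷ v)))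

-- Invariant means on abelian groups

record IsInvariantMean {G : Set} (_∙_ : Op₂ G) (𝔼 : (G → ℚ) → ℚ) : Set where
  field
    𝔼-cong      : ∀ {F F′ : G → ℚ} → (∀ x → F x ≡ F′ x) → 𝔼 F ≡ 𝔼 F′
    𝔼-distrib-+ : ∀ (F F′ : G → ℚ) → 𝔼 (λ x → F x + F′ x) ≡ 𝔼 F + 𝔼 F′
    𝔼-*ˡ        : ∀ c (F : G → ℚ) → 𝔼 (λ x → c * F x) ≡ c * 𝔼 F
    𝔼-1         : 𝔼 (λ _ → 1ℚ) ≡ 1ℚ
    𝔼-nonNeg    : ∀ {F : G → ℚ} → (∀ x → 0ℚ ≤ F x) → 0ℚ ≤ 𝔼 F
    𝔼-comm      : ∀ (F : G → G → ℚ) →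
                  𝔼 (λ x → 𝔼 (λ y → F x y)) ≡ 𝔼 (λ y → 𝔼 (λ x → F x y))
    𝔼-translate : ∀ t (F : G → ℚ) → 𝔼 (λ x → F (t ∙ x)) ≡ 𝔼 F

module InvariantMean
  {G : Set} {_·_ : Op₂ G} {ε : G} {inverse : Op₁ G}
  (isAbelianGroup : IsAbelianGroup _≡_ _·_ ε inverse)
  {𝔼 : (G → ℚ) → ℚ} (isInvariantMean : IsInvariantMean _·_ 𝔼)
  where

  open IsInvariantMean isInvariantMean public

  private
    abelianGroup : AbelianGroup 0ℓ 0ℓ
    abelianGroup = record { isAbelianGroup = isAbelianGroup }

  -- Taken from the bundle rather than the parameters, for their fixities.
  open AbelianGroup abelianGroup using (_∙_; _⁻¹; assoc; comm; ∙-congʳ; ∙-congˡ)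
  open import Algebra.Properties.AbelianGroup abelianGroup
    using (\\-leftDividesˡ; \\-leftDividesʳ; ⁻¹-involutive; ⁻¹-∙-comm)

  𝔼-syntax : (G → ℚ) → ℚ
  𝔼-syntax = 𝔼

  syntax 𝔼-syntax (λ x → e) = 𝔼[ x ] e

  𝔼-*ʳ : ∀ c F → 𝔼[ x ] (F x * c) ≡ 𝔼 F * c
  𝔼-*ʳ c F = trans (𝔼-cong λ x → ℚ.*-comm (F x) c) (trans (𝔼-*ˡ c F) (ℚ.*-comm c (𝔼 F)))

  𝔼-const : ∀ c → 𝔼[ _ ] c ≡ c
  𝔼-const c = begin
    𝔼[ _ ] c          ≡⟨ 𝔼-cong (λ _ → sym (ℚ.*-identityʳ c)) ⟩
    𝔼[ _ ] (c * 1ℚ)   ≡⟨ 𝔼-*ˡ c (λ _ → 1ℚ) ⟩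
    c * 𝔼[ _ ] 1ℚ     ≡⟨ cong (c *_) 𝔼-1 ⟩
    c * 1ℚ            ≡⟨ ℚ.*-identityʳ c ⟩
    c                 ∎

  𝔼-neg : ∀ F → 𝔼[ x ] (- F x) ≡ - 𝔼 F
  𝔼-neg F = begin
    𝔼[ x ] (- F x)        ≡⟨ 𝔼-cong (λ x → -p≡-1*p (F x)) ⟩
    𝔼[ x ] (- 1ℚ * F x)   ≡⟨ 𝔼-*ˡ (- 1ℚ) F ⟩
    - 1ℚ * 𝔼 F            ≡⟨ -p≡-1*p (𝔼 F) ⟨
    - 𝔼 F                 ∎
    where
    -p≡-1*p : ∀ p → - p ≡ - 1ℚ * p
    -p≡-1*p = solve-∀ ℚ-ring

  𝔼-distrib-- : ∀ F F′ → 𝔼[ x ] (F x - F′ x) ≡ 𝔼 F - 𝔼 F′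
  𝔼-distrib-- F F′ = trans (𝔼-distrib-+ F (λ x → - F′ x)) (cong (_+_ (𝔼 F)) (𝔼-neg F′))

  𝔼-translateʳ : ∀ t F → 𝔼[ x ] F (x ∙ t) ≡ 𝔼 F
  𝔼-translateʳ t F = trans (𝔼-cong λ x → cong F (comm x t)) (𝔼-translate t F)

  𝔼²-*ˡ : ∀ c (F : G → G → ℚ) → 𝔼[ x ] 𝔼[ y ] (c * F x y) ≡ c * 𝔼[ x ] 𝔼[ y ] F x y
  𝔼²-*ˡ c F = trans (𝔼-cong λ x → 𝔼-*ˡ c (F x)) (𝔼-*ˡ c _)

  𝔼-comm₃ : ∀ (F : G → G → G → ℚ) →
            𝔼[ x ] 𝔼[ y ] 𝔼[ z ] F x y z ≡ 𝔼[ y ] 𝔼[ z ] 𝔼[ x ] F x y z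
  𝔼-comm₃ F = trans (𝔼-comm _) (𝔼-cong λ y → 𝔼-comm (λ x z → F x y z))

  corr : (G → ℚ) → G → ℚ
  corr u d = 𝔼[ a ] (u a * u (a ∙ d))

  T₄ : (G → ℚ) → ℚ
  T₄ u = 𝔼[ a ] 𝔼[ b ] 𝔼[ c ] (u a * (u b * (u c * u (a ∙ b ⁻¹ ∙ c))))

  T₅ : (G → ℚ) → ℚ
  T₅ u = 𝔼[ a ] 𝔼[ b ] 𝔼[ c ] 𝔼[ d ] (u a * (u b * (u c * (u d * u (a ⁻¹ ∙ b ∙ c ⁻¹ ∙ d)))))

  𝔼-corr : ∀ u → 𝔼 (corr u) ≡ 𝔼 u * 𝔼 u
  𝔼-corr u = begin
    𝔼[ d ] 𝔼[ a ] (u a * u (a ∙ d))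
      ≡⟨ 𝔼-comm _ ⟩
    𝔼[ a ] 𝔼[ d ] (u a * u (a ∙ d))
      ≡⟨ 𝔼-cong (λ a → trans (𝔼-*ˡ (u a) _) (cong (u a *_) (𝔼-translate a u))) ⟩
    𝔼[ a ] (u a * 𝔼 u)
      ≡⟨ 𝔼-*ʳ (𝔼 u) u ⟩
    𝔼 u * 𝔼 u
      ∎

  -- Substitute c = b ∙ d and average over b first.
  𝔼-pair : ∀ (v H : G → ℚ) → 𝔼[ b ] 𝔼[ c ] (v b * (v c * H (b ⁻¹ ∙ c))) ≡ 𝔼[ d ] (corr v d * H d)
  𝔼-pair v H = begin
    𝔼[ b ] 𝔼[ c ] (v b * (v c * H (b ⁻¹ ∙ c)))
      ≡⟨ 𝔼-cong (λ b → 𝔼-cong λ c → trans (sym (ℚ.*-assoc (v b) _ _))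
           (cong (λ z → v b * v z * H (b ⁻¹ ∙ c)) (sym (\\-leftDividesˡ b c)))) ⟩
    𝔼[ b ] 𝔼[ c ] (v b * v (b ∙ (b ⁻¹ ∙ c)) * H (b ⁻¹ ∙ c))
      ≡⟨ 𝔼-cong (λ b → 𝔼-translate (b ⁻¹) (λ d → v b * v (b ∙ d) * H d)) ⟩
    𝔼[ b ] 𝔼[ d ] (v b * v (b ∙ d) * H d)
      ≡⟨ 𝔼-comm _ ⟩
    𝔼[ d ] 𝔼[ b ] (v b * v (b ∙ d) * H d)
      ≡⟨ 𝔼-cong (λ d → 𝔼-*ʳ (H d) _) ⟩
    𝔼[ d ] (corr v d * H d)
      ∎

  T₄≡𝔼corr² : ∀ u → T₄ u ≡ 𝔼[ d ] (corr u d * corr u d)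
  T₄≡𝔼corr² u = begin
    T₄ u
      ≡⟨ 𝔼-comm₃ _ ⟩
    𝔼[ b ] 𝔼[ c ] 𝔼[ a ] (u a * (u b * (u c * u (a ∙ b ⁻¹ ∙ c))))
      ≡⟨ 𝔼-cong (λ b → 𝔼-cong (pull-out b)) ⟩
    𝔼[ b ] 𝔼[ c ] (u b * (u c * corr u (b ⁻¹ ∙ c)))
      ≡⟨ 𝔼-pair u (corr u) ⟩
    𝔼[ d ] (corr u d * corr u d)
      ∎
    where
    regroup : ∀ x y z w → x * (y * (z * w)) ≡ y * z * (x * w)
    regroup = solve-∀ ℚ-ring

    pull-out : ∀ b c → 𝔼[ a ] (u a * (u b * (u c * u (a ∙ b ⁻¹ ∙ c)))) ≡ u b * (u c * corr u (b ⁻¹ ∙ c))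
    pull-out b c = begin
      𝔼[ a ] (u a * (u b * (u c * u (a ∙ b ⁻¹ ∙ c))))
        ≡⟨ 𝔼-cong (λ a → trans (regroup (u a) (u b) (u c) _)
             (cong (λ z → u b * u c * (u a * u z)) (assoc a (b ⁻¹) c))) ⟩
      𝔼[ a ] (u b * u c * (u a * u (a ∙ (b ⁻¹ ∙ c))))
        ≡⟨ 𝔼-*ˡ (u b * u c) _ ⟩
      u b * u c * corr u (b ⁻¹ ∙ c)
        ≡⟨ ℚ.*-assoc (u b) (u c) _ ⟩
      u b * (u c * corr u (b ⁻¹ ∙ c))
        ∎

  T₅≡𝔼*corr∘corr : ∀ u → T₅ u ≡ 𝔼[ y ] (u y * corr (corr u) y)
  T₅≡𝔼*corr∘corr u = begin
    T₅ u
      ≡⟨ 𝔼-comm _ ⟩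
    𝔼[ a ] 𝔼[ x ] 𝔼[ b ] 𝔼[ z ] (u x * (u a * (u b * (u z * u (x ⁻¹ ∙ a ∙ b ⁻¹ ∙ z)))))
      ≡⟨ 𝔼-cong (λ a → 𝔼-cong (pull-out a)) ⟩
    𝔼[ a ] 𝔼[ x ] (u a * (u x * 𝔼[ b ] 𝔼[ z ] (u b * (u z * u ((a ⁻¹ ∙ x) ⁻¹ ∙ (b ⁻¹ ∙ z))))))
      ≡⟨ 𝔼-cong (λ a → 𝔼-cong λ x →
           cong (λ t → u a * (u x * t)) (𝔼-pair u (λ e → u ((a ⁻¹ ∙ x) ⁻¹ ∙ e)))) ⟩
    𝔼[ a ] 𝔼[ x ] (u a * (u x * 𝔼[ e ] (corr u e * u ((a ⁻¹ ∙ x) ⁻¹ ∙ e))))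
      ≡⟨ 𝔼-pair u (λ d → 𝔼[ e ] (corr u e * u (d ⁻¹ ∙ e))) ⟩
    𝔼[ d ] (corr u d * 𝔼[ e ] (corr u e * u (d ⁻¹ ∙ e)))
      ≡⟨ 𝔼-cong (λ d → cong (corr u d *_) (trans (sym (𝔼-translate d _))
           (𝔼-cong λ y → cong (λ z → corr u (d ∙ y) * u z) (\\-leftDividesʳ d y)))) ⟩
    𝔼[ d ] (corr u d * 𝔼[ y ] (corr u (d ∙ y) * u y))
      ≡⟨ 𝔼-cong (λ d → sym (𝔼-*ˡ (corr u d) _)) ⟩
    𝔼[ d ] 𝔼[ y ] (corr u d * (corr u (d ∙ y) * u y))
      ≡⟨ 𝔼-comm _ ⟩
    𝔼[ y ] 𝔼[ d ] (corr u d * (corr u (d ∙ y) * u y))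
      ≡⟨ 𝔼-cong (λ y → trans (𝔼-cong λ d → rotate (corr u d) _ (u y)) (𝔼-*ˡ (u y) _)) ⟩
    𝔼[ y ] (u y * corr (corr u) y)
      ∎
    where
    rotate : ∀ x y z → x * (y * z) ≡ z * (x * y)
    rotate = solve-∀ ℚ-ring

    regroup : ∀ x a y → x * (a * y) ≡ a * x * y
    regroup = solve-∀ ℚ-ring

    x⁻¹∙a≡[a⁻¹∙x]⁻¹ : ∀ a x → x ⁻¹ ∙ a ≡ (a ⁻¹ ∙ x) ⁻¹
    x⁻¹∙a≡[a⁻¹∙x]⁻¹ a x = begin
      x ⁻¹ ∙ a          ≡⟨ ∙-congˡ (sym (⁻¹-involutive a)) ⟩
      x ⁻¹ ∙ a ⁻¹ ⁻¹    ≡⟨ ⁻¹-∙-comm x (a ⁻¹) ⟩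
      (x ∙ a ⁻¹) ⁻¹     ≡⟨ cong _⁻¹ (comm x (a ⁻¹)) ⟩
      (a ⁻¹ ∙ x) ⁻¹     ∎

    pull-out : ∀ a x →
      𝔼[ b ] 𝔼[ z ] (u x * (u a * (u b * (u z * u (x ⁻¹ ∙ a ∙ b ⁻¹ ∙ z))))) ≡
      u a * (u x * 𝔼[ b ] 𝔼[ z ] (u b * (u z * u ((a ⁻¹ ∙ x) ⁻¹ ∙ (b ⁻¹ ∙ z)))))
    pull-out a x = begin
      𝔼[ b ] 𝔼[ z ] (u x * (u a * (u b * (u z * u (x ⁻¹ ∙ a ∙ b ⁻¹ ∙ z)))))
        ≡⟨ 𝔼-cong (λ b → 𝔼-cong λ z → trans (regroup (u x) (u a) _)
             (cong (λ w → u a * u x * (u b * (u z * u w)))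
               (trans (assoc (x ⁻¹ ∙ a) (b ⁻¹) z) (∙-congʳ (x⁻¹∙a≡[a⁻¹∙x]⁻¹ a x))))) ⟩
      𝔼[ b ] 𝔼[ z ] (u a * u x * (u b * (u z * u ((a ⁻¹ ∙ x) ⁻¹ ∙ (b ⁻¹ ∙ z)))))
        ≡⟨ 𝔼²-*ˡ (u a * u x) _ ⟩
      u a * u x * 𝔼[ b ] 𝔼[ z ] (u b * (u z * u ((a ⁻¹ ∙ x) ⁻¹ ∙ (b ⁻¹ ∙ z))))
        ≡⟨ ℚ.*-assoc (u a) (u x) _ ⟩
      u a * (u x * 𝔼[ b ] 𝔼[ z ] (u b * (u z * u ((a ⁻¹ ∙ x) ⁻¹ ∙ (b ⁻¹ ∙ z)))))
        ∎

  corr≤𝔼² : ∀ v y → corr v y ≤ 𝔼[ d ] (v d * v d)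
  corr≤𝔼² v y = 0≤q-p⇒p≤q (subst (0ℚ ≤_) half-square-expansion
    (𝔼-nonNeg λ d → *-nonNeg (ℚ.nonNegative⁻¹ ½) (square-nonNeg (v d - v (d ∙ y)))))
    where
    expand : ∀ x x′ → ½ * ((x - x′) * (x - x′)) ≡ ½ * (x * x) + ½ * (x′ * x′) - x * x′
    expand = solve-∀ ℚ-ring

    halves : ∀ S K → ½ * S + ½ * S - K ≡ S - K
    halves = solve-∀ ℚ-ring

    half-square-expansion :
      𝔼[ d ] (½ * ((v d - v (d ∙ y)) * (v d - v (d ∙ y)))) ≡ 𝔼[ d ] (v d * v d) - corr v y
    half-square-expansion = begin
      𝔼[ d ] (½ * ((v d - v (d ∙ y)) * (v d - v (d ∙ y))))
        ≡⟨ 𝔼-cong (λ d → expand (v d) (v (d ∙ y))) ⟩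
      𝔼[ d ] (½ * (v d * v d) + ½ * (v (d ∙ y) * v (d ∙ y)) - v d * v (d ∙ y))
        ≡⟨ 𝔼-distrib-- _ _ ⟩
      𝔼[ d ] (½ * (v d * v d) + ½ * (v (d ∙ y) * v (d ∙ y))) - corr v y
        ≡⟨ cong (_- corr v y) (𝔼-distrib-+ _ _) ⟩
      𝔼[ d ] (½ * (v d * v d)) + 𝔼[ d ] (½ * (v (d ∙ y) * v (d ∙ y))) - corr v y
        ≡⟨ cong₂ (λ s t → s + t - corr v y) (𝔼-*ˡ ½ _)
             (trans (𝔼-*ˡ ½ _) (cong (½ *_) (𝔼-translateʳ y (λ d → v d * v d)))) ⟩
      ½ * 𝔼[ d ] (v d * v d) + ½ * 𝔼[ d ] (v d * v d) - corr v y
        ≡⟨ halves (𝔼[ d ] (v d * v d)) (corr v y) ⟩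
      𝔼[ d ] (v d * v d) - corr v y
        ∎

  𝔼-weighted-corr≤ : ∀ {w : G → ℚ} → (∀ y → 0ℚ ≤ w y) → ∀ v →
                     0ℚ ≤ 𝔼 w * 𝔼[ d ] (v d * v d) - 𝔼[ y ] (w y * corr v y)
  𝔼-weighted-corr≤ {w} 0≤w v = subst (0ℚ ≤_) distribute
    (𝔼-nonNeg λ y → *-nonNeg (0≤w y) (p≤q⇒0≤q-p (corr≤𝔼² v y)))
    where
    S = 𝔼[ d ] (v d * v d)
    distribute : 𝔼[ y ] (w y * (S - corr v y)) ≡ 𝔼 w * S - 𝔼[ y ] (w y * corr v y)
    distribute = trans (𝔼-cong λ y → ℚ.*-distribˡ-+ (w y) S (- corr v y))
      (trans (𝔼-distrib-+ _ _)
        (cong₂ _+_ (𝔼-*ʳ S w) (trans (𝔼-cong λ y → sym (ℚ.neg-distribʳ-* (w y) _)) (𝔼-neg _))))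

  𝔼-*-shift : ∀ {u v h k : G → ℚ} {α β} → (∀ x → u x ≡ α + h x) → (∀ x → v x ≡ β + k x) →
              𝔼 h ≡ 0ℚ → 𝔼 k ≡ 0ℚ → 𝔼[ x ] (u x * v x) ≡ α * β + 𝔼[ x ] (h x * k x)
  𝔼-*-shift {u} {v} {h} {k} {α} {β} u≗α+h v≗β+k 𝔼h≡0 𝔼k≡0 = begin
    𝔼[ x ] (u x * v x)
      ≡⟨ 𝔼-cong (λ x → trans (cong₂ _*_ (u≗α+h x) (v≗β+k x)) (expand α β (h x) (k x))) ⟩
    𝔼[ x ] (α * β + ((α * k x + β * h x) + h x * k x))
      ≡⟨ trans (𝔼-distrib-+ _ _) (cong₂ _+_ (𝔼-const (α * β)) (𝔼-distrib-+ _ _)) ⟩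
    α * β + (𝔼[ x ] (α * k x + β * h x) + 𝔼[ x ] (h x * k x))
      ≡⟨ cong (λ t → α * β + (t + 𝔼[ x ] (h x * k x)))
           (trans (𝔼-distrib-+ _ _) (cong₂ _+_ (𝔼-*ˡ α k) (𝔼-*ˡ β h))) ⟩
    α * β + (α * 𝔼 k + β * 𝔼 h + 𝔼[ x ] (h x * k x))
      ≡⟨ cong₂ (λ s t → α * β + (α * s + β * t + 𝔼[ x ] (h x * k x))) 𝔼k≡0 𝔼h≡0 ⟩
    α * β + (α * 0ℚ + β * 0ℚ + 𝔼[ x ] (h x * k x))
      ≡⟨ drop-zeros α β _ ⟩
    α * β + 𝔼[ x ] (h x * k x)
      ∎
    where
    expand : ∀ α β x y → (α + x) * (β + y) ≡ α * β + ((α * y + β * x) + x * y)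
    expand = solve-∀ ℚ-ring

    drop-zeros : ∀ α β z → α * β + (α * 0ℚ + β * 0ℚ + z) ≡ α * β + z
    drop-zeros = solve-∀ ℚ-ring

  𝔼-corr≡0 : ∀ {h} → 𝔼 h ≡ 0ℚ → 𝔼 (corr h) ≡ 0ℚ
  𝔼-corr≡0 {h} 𝔼h≡0 = trans (𝔼-corr h) (trans (cong₂ _*_ 𝔼h≡0 𝔼h≡0) (ℚ.*-zeroˡ 0ℚ))

  corr-shift : ∀ {u h : G → ℚ} {α} → (∀ x → u x ≡ α + h x) → 𝔼 h ≡ 0ℚ →
               ∀ d → corr u d ≡ α * α + corr h d
  corr-shift {u} {h} {α} u≗α+h 𝔼h≡0 d =
    𝔼-*-shift {α = α} {β = α} u≗α+h (λ a → u≗α+h (a ∙ d)) 𝔼h≡0 (trans (𝔼-translateʳ d h) 𝔼h≡0)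

  corr-neg : ∀ h d → corr (λ x → - h x) d ≡ corr h d
  corr-neg h d = 𝔼-cong λ a → neg*neg (h a) (h (a ∙ d))
    where
    neg*neg : ∀ x y → - x * - y ≡ x * y
    neg*neg = solve-∀ ℚ-ring

  T₄-shift : ∀ {u h : G → ℚ} {α} → (∀ x → u x ≡ α + h x) → 𝔼 h ≡ 0ℚ → T₄ u ≡ α ^ 4 + T₄ h
  T₄-shift {u} {h} {α} u≗α+h 𝔼h≡0 = begin
    T₄ u
      ≡⟨ T₄≡𝔼corr² u ⟩
    𝔼[ d ] (corr u d * corr u d)
      ≡⟨ 𝔼-*-shift {α = α * α} {β = α * α} corr-u corr-u 𝔼corr≡0 𝔼corr≡0 ⟩
    α * α * (α * α) + 𝔼[ d ] (corr h d * corr h d)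
      ≡⟨ cong₂ _+_ (α²α²≡α⁴ α) (sym (T₄≡𝔼corr² h)) ⟩
    α ^ 4 + T₄ h
      ∎
    where
    corr-u = corr-shift {α = α} u≗α+h 𝔼h≡0
    𝔼corr≡0 = 𝔼-corr≡0 𝔼h≡0
    α²α²≡α⁴ : ∀ α → α * α * (α * α) ≡ α ^ 4
    α²α²≡α⁴ = solve-∀ ℚ-ring

  T₅-shift : ∀ {u h : G → ℚ} {α} → (∀ x → u x ≡ α + h x) → 𝔼 h ≡ 0ℚ → T₅ u ≡ α ^ 5 + T₅ h
  T₅-shift {u} {h} {α} u≗α+h 𝔼h≡0 = begin
    T₅ u
      ≡⟨ T₅≡𝔼*corr∘corr u ⟩
    𝔼[ y ] (u y * corr (corr u) y)
      ≡⟨ 𝔼-*-shift {α = α} {β = α * α * (α * α)} u≗α+h corr-corr-u 𝔼h≡0 (𝔼-corr≡0 (𝔼-corr≡0 𝔼h≡0)) ⟩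
    α * (α * α * (α * α)) + 𝔼[ y ] (h y * corr (corr h) y)
      ≡⟨ cong₂ _+_ (α·α²α²≡α⁵ α) (sym (T₅≡𝔼*corr∘corr h)) ⟩
    α ^ 5 + T₅ h
      ∎
    where
    corr-corr-u = corr-shift {α = α * α} (corr-shift {α = α} u≗α+h 𝔼h≡0) (𝔼-corr≡0 𝔼h≡0)
    α·α²α²≡α⁵ : ∀ α → α * (α * α * (α * α)) ≡ α ^ 5
    α·α²α²≡α⁵ = solve-∀ ℚ-ring

  T₄-neg : ∀ h → T₄ (λ x → - h x) ≡ T₄ h
  T₄-neg h = begin
    T₄ (λ x → - h x)
      ≡⟨ T₄≡𝔼corr² (λ x → - h x) ⟩
    𝔼[ d ] (corr (λ x → - h x) d * corr (λ x → - h x) d)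
      ≡⟨ 𝔼-cong (λ d → cong₂ _*_ (corr-neg h d) (corr-neg h d)) ⟩
    𝔼[ d ] (corr h d * corr h d)
      ≡⟨ T₄≡𝔼corr² h ⟨
    T₄ h
      ∎

  T₅-neg : ∀ h → T₅ (λ x → - h x) ≡ - T₅ h
  T₅-neg h = begin
    T₅ (λ x → - h x)
      ≡⟨ T₅≡𝔼*corr∘corr (λ x → - h x) ⟩
    𝔼[ y ] (- h y * corr (corr (λ x → - h x)) y)
      ≡⟨ 𝔼-cong (λ y → cong (- h y *_) (𝔼-cong λ d → cong₂ _*_ (corr-neg h d) (corr-neg h (d ∙ y)))) ⟩
    𝔼[ y ] (- h y * corr (corr h) y)
      ≡⟨ 𝔼-cong (λ y → sym (ℚ.neg-distribˡ-* (h y) _)) ⟩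
    𝔼[ y ] (- (h y * corr (corr h) y))
      ≡⟨ 𝔼-neg _ ⟩
    - 𝔼[ y ] (h y * corr (corr h) y)
      ≡⟨ cong -_ (T₅≡𝔼*corr∘corr h) ⟨
    - T₅ h
      ∎

  𝔼-shift : ∀ {w g : G → ℚ} {α} → (∀ x → w x ≡ α + g x) → 𝔼 g ≡ 0ℚ → 𝔼 w ≡ α
  𝔼-shift {w} {g} {α} w≗α+g 𝔼g≡0 = begin
    𝔼 w                ≡⟨ 𝔼-cong w≗α+g ⟩
    𝔼[ x ] (α + g x)   ≡⟨ 𝔼-distrib-+ (λ _ → α) g ⟩
    𝔼[ _ ] α + 𝔼 g     ≡⟨ cong₂ _+_ (𝔼-const α) 𝔼g≡0 ⟩
    α + 0ℚ             ≡⟨ ℚ.+-identityʳ α ⟩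
    α                  ∎

  𝔼-centre : ∀ f → 𝔼[ x ] (f x - 𝔼 f) ≡ 0ℚ
  𝔼-centre f = trans (𝔼-distrib-- f (λ _ → 𝔼 f)) (trans (cong (_-_ (𝔼 f)) (𝔼-const (𝔼 f))) (ℚ.+-inverseʳ (𝔼 f)))

  T₄-nonNeg : ∀ u → 0ℚ ≤ T₄ u
  T₄-nonNeg u = subst (0ℚ ≤_) (sym (T₄≡𝔼corr² u)) (𝔼-nonNeg λ d → square-nonNeg (corr u d))

  0≤α*T₄-T₅ : ∀ {w g : G → ℚ} {α} → (∀ x → 0ℚ ≤ w x) → (∀ x → w x ≡ α + g x) → 𝔼 g ≡ 0ℚ →
              0ℚ ≤ α * T₄ g - T₅ g
  0≤α*T₄-T₅ {w} {g} {α} 0≤w w≗α+g 𝔼g≡0 = subst (0ℚ ≤_)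
    (cong₂ _-_ (cong₂ _*_ (𝔼-shift {α = α} w≗α+g 𝔼g≡0) (sym (T₄≡𝔼corr² g))) 𝔼[w*corr²g]≡T₅g)
    (𝔼-weighted-corr≤ 0≤w (corr g))
    where
    𝔼[w*corr²g]≡T₅g : 𝔼[ y ] (w y * corr (corr g) y) ≡ T₅ g
    𝔼[w*corr²g]≡T₅g = begin
      𝔼[ y ] (w y * corr (corr g) y)
        ≡⟨ 𝔼-*-shift {α = α} {β = 0ℚ} w≗α+g (λ y → sym (ℚ.+-identityˡ _)) 𝔼g≡0 (𝔼-corr≡0 (𝔼-corr≡0 𝔼g≡0)) ⟩
      α * 0ℚ + 𝔼[ y ] (g y * corr (corr g) y)
        ≡⟨ trans (cong (_+ _) (ℚ.*-zeroʳ α)) (ℚ.+-identityˡ _) ⟩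
      𝔼[ y ] (g y * corr (corr g) y)
        ≡⟨ T₅≡𝔼*corr∘corr g ⟨
      T₅ g
        ∎

  T₄T₅-complement-bound : ∀ (f : G → ℚ) → (∀ x → (0ℚ ≤ f x) × (f x ≤ 1ℚ)) →
    + 1 / 256 ≤ T₄ f * T₅ f + T₄ (λ x → 1ℚ - f x) * T₅ (λ x → 1ℚ - f x)
  T₄T₅-complement-bound f 0≤f≤1 = subst (+ 1 / 256 ≤_) (sym decomposition)
    (complement-bound (𝔼-nonNeg 0≤f) 0≤1-α (T₄-nonNeg h) (0≤α*T₄-T₅ {α = α} 0≤f f≗α+h 𝔼h≡0) 0≤[1-α]T₄h+T₅h)
    where
    α = 𝔼 f

    h : G → ℚ
    h x = f x - α

    f≗α+h : ∀ x → f x ≡ α + h x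
    f≗α+h x = regroup (f x) α
      where
      regroup : ∀ y α → y ≡ α + (y - α)
      regroup = solve-∀ ℚ-ring

    1-f≗1-α-h : ∀ x → 1ℚ - f x ≡ (1ℚ - α) + - h x
    1-f≗1-α-h x = regroup (f x) α
      where
      regroup : ∀ y α → 1ℚ - y ≡ (1ℚ - α) + - (y - α)
      regroup = solve-∀ ℚ-ring

    𝔼h≡0 : 𝔼 h ≡ 0ℚ
    𝔼h≡0 = 𝔼-centre f

    𝔼-h≡0 : 𝔼[ x ] (- h x) ≡ 0ℚ
    𝔼-h≡0 = trans (𝔼-neg h) (cong -_ 𝔼h≡0)

    0≤f : ∀ x → 0ℚ ≤ f x
    0≤f x = proj₁ (0≤f≤1 x)

    0≤1-f : ∀ x → 0ℚ ≤ 1ℚ - f x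
    0≤1-f x = p≤q⇒0≤q-p (proj₂ (0≤f≤1 x))

    0≤1-α : 0ℚ ≤ 1ℚ - α
    0≤1-α = subst (0ℚ ≤_) (𝔼-shift {α = 1ℚ - α} 1-f≗1-α-h 𝔼-h≡0) (𝔼-nonNeg 0≤1-f)

    0≤[1-α]T₄h+T₅h : 0ℚ ≤ (1ℚ - α) * T₄ h + T₅ h
    0≤[1-α]T₄h+T₅h = subst (0ℚ ≤_)
      (trans (cong₂ (λ s e → (1ℚ - α) * s - e) (T₄-neg h) (T₅-neg h)) (minus-neg ((1ℚ - α) * T₄ h) (T₅ h)))
      (0≤α*T₄-T₅ {α = 1ℚ - α} 0≤1-f 1-f≗1-α-h 𝔼-h≡0)
      where
      minus-neg : ∀ x y → x - - y ≡ x + y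
      minus-neg = solve-∀ ℚ-ring

    decomposition : T₄ f * T₅ f + T₄ (λ x → 1ℚ - f x) * T₅ (λ x → 1ℚ - f x) ≡
                    (α ^ 4 + T₄ h) * (α ^ 5 + T₅ h) + ((1ℚ - α) ^ 4 + T₄ h) * ((1ℚ - α) ^ 5 - T₅ h)
    decomposition = cong₂ _+_
      (cong₂ _*_ (T₄-shift {α = α} f≗α+h 𝔼h≡0) (T₅-shift {α = α} f≗α+h 𝔼h≡0))
      (cong₂ _*_ (trans (T₄-shift {α = 1ℚ - α} 1-f≗1-α-h 𝔼-h≡0) (cong (_+_ ((1ℚ - α) ^ 4)) (T₄-neg h)))
                 (trans (T₅-shift {α = 1ℚ - α} 1-f≗1-α-h 𝔼-h≡0) (cong (_+_ ((1ℚ - α) ^ 5)) (T₅-neg h))))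

module UniformMean {A : Set} (_∙_ : Op₂ A) (xs : List A)
  (∑-translate : ∀ t (F : A → ℚ) → ∑[ x ∈ xs ] F (t ∙ x) ≡ ∑ xs F)
  .{{_ : Positive (∑[ _ ∈ xs ] 1ℚ)}}
  where

  |xs| : ℚ
  |xs| = ∑[ _ ∈ xs ] 1ℚ

  instance
    |xs|≢0 : Data.Rational.NonZero |xs|
    |xs|≢0 = ℚ.pos⇒nonZero |xs|

  𝔼 : (A → ℚ) → ℚ
  𝔼 F = 1/ |xs| * ∑ xs F

  isInvariantMean : IsInvariantMean _∙_ 𝔼
  isInvariantMean = record
    { 𝔼-cong      = λ F≗F′ → cong (_*_ (1/ |xs|)) (∑-cong xs F≗F′)
    ; 𝔼-distrib-+ = λ F F′ → trans (cong (_*_ (1/ |xs|)) (∑-distrib-+ xs F F′)) (ℚ.*-distribˡ-+ (1/ |xs|) _ _)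
    ; 𝔼-*ˡ        = λ c F → trans (cong (_*_ (1/ |xs|)) (∑-*ˡ xs c F)) (swap (1/ |xs|) c (∑ xs F))
    ; 𝔼-1         = ℚ.*-inverseˡ |xs|
    ; 𝔼-nonNeg    = λ 0≤F → *-nonNeg 0≤1/|xs| (∑-nonNeg xs 0≤F)
    ; 𝔼-comm      = λ F → begin
        1/ |xs| * ∑[ x ∈ xs ] (1/ |xs| * ∑[ y ∈ xs ] F x y)
          ≡⟨ cong (_*_ (1/ |xs|)) (∑-*ˡ xs (1/ |xs|) _) ⟩
        1/ |xs| * (1/ |xs| * ∑[ x ∈ xs ] ∑[ y ∈ xs ] F x y)
          ≡⟨ cong (λ s → 1/ |xs| * (1/ |xs| * s)) (∑-comm xs xs F) ⟩
        1/ |xs| * (1/ |xs| * ∑[ y ∈ xs ] ∑[ x ∈ xs ] F x y)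
          ≡⟨ cong (_*_ (1/ |xs|)) (∑-*ˡ xs (1/ |xs|) _) ⟨
        1/ |xs| * ∑[ y ∈ xs ] (1/ |xs| * ∑[ x ∈ xs ] F x y)
          ∎
    ; 𝔼-translate = λ t F → cong (_*_ (1/ |xs|)) (∑-translate t F)
    }
    where
    swap : ∀ a c s → a * (c * s) ≡ c * (a * s)
    swap = solve-∀ ℚ-ring

    0≤1/|xs| : 0ℚ ≤ 1/ |xs|
    0≤1/|xs| = ℚ.nonNegative⁻¹ (1/ |xs|) {{ℚ.pos⇒nonNeg (1/ |xs|) {{ℚ.1/pos⇒pos |xs|}}}}

  nested-𝔼 : ∀ k (F : Vec A k → ℚ) → nested 𝔼 k F ≡ (1/ |xs|) ^ k * nested (∑ xs) k F
  nested-𝔼 zero    F = sym (ℚ.*-identityˡ (F []))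
  nested-𝔼 (suc k) F = begin
    1/ |xs| * ∑[ x ∈ xs ] nested 𝔼 k (F ∘ (x ∷_))
      ≡⟨ cong (_*_ (1/ |xs|)) (∑-cong xs λ x → nested-𝔼 k (F ∘ (x ∷_))) ⟩
    1/ |xs| * ∑[ x ∈ xs ] ((1/ |xs|) ^ k * nested (∑ xs) k (F ∘ (x ∷_)))
      ≡⟨ cong (_*_ (1/ |xs|)) (∑-*ˡ xs ((1/ |xs|) ^ k) _) ⟩
    1/ |xs| * ((1/ |xs|) ^ k * ∑[ x ∈ xs ] nested (∑ xs) k (F ∘ (x ∷_)))
      ≡⟨ ℚ.*-assoc (1/ |xs|) _ _ ⟨
    1/ |xs| * (1/ |xs|) ^ k * nested (∑ xs) (suc k) F
      ≡⟨ cong (_* nested (∑ xs) (suc k) F) (^-homo-* (1/ |xs|) 1 k) ⟨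
    (1/ |xs|) ^ suc k * nested (∑ xs) (suc k) F
      ∎

-- The group ℤ/pℤ and its powers

module ℤMod (p : ℕ) .{{_ : NonZero p}} where

  infix 4 _≈_

  -- Congruence modulo p, wrapped in a record so that x and y stay inferable.
  record _≈_ (x y : ℤ) : Set where
    constructor mod-p
    field divides-difference : + p ∣ x ℤ.- y

  ≈-reflexive : ∀ {x y} → x ≡ y → x ≈ y
  ≈-reflexive {x} refl = mod-p (divides 0ℤ (trans (ℤ.+-inverseʳ x) (sym (ℤ.*-zeroˡ (+ p)))))

  ≈-refl : ∀ {x} → x ≈ x
  ≈-refl = ≈-reflexive refl

  ≈-sym : ∀ {x y} → x ≈ y → y ≈ x
  ≈-sym {x} {y} (mod-p p∣x-y) = mod-p (subst (+ p ∣_) (flip x y) (∣m⇒∣-m p∣x-y))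
    where
    flip : ∀ x y → ℤ.- (x ℤ.- y) ≡ y ℤ.- x
    flip = solve-∀ ℤ-ring

  ≈-trans : ∀ {x y z} → x ≈ y → y ≈ z → x ≈ z
  ≈-trans {x} {y} {z} (mod-p p∣x-y) (mod-p p∣y-z) =
    mod-p (subst (+ p ∣_) (telescope x y z) (∣m∣n⇒∣m+n p∣x-y p∣y-z))
    where
    telescope : ∀ x y z → (x ℤ.- y) ℤ.+ (y ℤ.- z) ≡ x ℤ.- z
    telescope = solve-∀ ℤ-ring

  ≈-sym⇔ : ∀ {x y} → x ≈ y ⇔ y ≈ x
  ≈-sym⇔ = mk⇔ ≈-sym ≈-sym

  +-cong : ∀ {x x′ y y′} → x ≈ x′ → y ≈ y′ → x ℤ.+ y ≈ x′ ℤ.+ y′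
  +-cong {x} {x′} {y} {y′} (mod-p p∣x-x′) (mod-p p∣y-y′) =
    mod-p (subst (+ p ∣_) (interchange x x′ y y′) (∣m∣n⇒∣m+n p∣x-x′ p∣y-y′))
    where
    interchange : ∀ x x′ y y′ → (x ℤ.- x′) ℤ.+ (y ℤ.- y′) ≡ (x ℤ.+ y) ℤ.- (x′ ℤ.+ y′)
    interchange = solve-∀ ℤ-ring

  x-y≈0⇔x≈y : ∀ {x y} → x ℤ.- y ≈ 0ℤ ⇔ x ≈ y
  x-y≈0⇔x≈y {x} {y} = mk⇔
    (λ (mod-p p∣x-y-0) → mod-p (subst (+ p ∣_) (ℤ.+-identityʳ (x ℤ.- y)) p∣x-y-0))
    (λ (mod-p p∣x-y) → mod-p (subst (+ p ∣_) (sym (ℤ.+-identityʳ (x ℤ.- y))) p∣x-y))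

  %ℕ-≈ : ∀ z → + (z ℤ.%ℕ p) ≈ z
  %ℕ-≈ z = mod-p $ divides (ℤ.- (z ℤ./ℕ p)) $ begin
      + (z ℤ.%ℕ p) ℤ.- z
        ≡⟨ cong (ℤ._-_ (+ (z ℤ.%ℕ p))) (a≡a%ℕn+[a/ℕn]*n z p) ⟩
      + (z ℤ.%ℕ p) ℤ.- (+ (z ℤ.%ℕ p) ℤ.+ (z ℤ./ℕ p) ℤ.* + p)
        ≡⟨ cancel (+ (z ℤ.%ℕ p)) (z ℤ./ℕ p) (+ p) ⟩
      ℤ.- (z ℤ./ℕ p) ℤ.* + p
        ∎
    where
    cancel : ∀ r q d → r ℤ.- (r ℤ.+ q ℤ.* d) ≡ ℤ.- q ℤ.* d
    cancel = solve-∀ ℤ-ring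

  -- Two residues below p that are congruent differ by less than p, hence by 0.
  ≈-unique : ∀ {a b} → a ℕ.< p → b ℕ.< p → + a ≈ + b → a ≡ b
  ≈-unique {a} {b} a<p b<p (mod-p p∣a-b) =
    ℤ.+-injective (ℤ.i-j≡0⇒i≡j (+ a) (+ b) (ℤ.∣i∣≡0⇒i≡0 ∣a-b∣≡0))
    where
    ∣a-b∣<p : ℤ.∣ + a ℤ.- + b ∣ ℕ.< p
    ∣a-b∣<p = subst (ℕ._< p) (cong ℤ.∣_∣ (sym (ℤ.m-n≡m⊖n a b)))
      (ℕ.≤-<-trans (ℤ.∣m⊝n∣≤m⊔n a b) (ℕ.⊔-lub a<p b<p))

    ∣a-b∣≡0 : ℤ.∣ + a ℤ.- + b ∣ ≡ 0
    ∣a-b∣≡0 = trans (sym (m<n⇒m%n≡m ∣a-b∣<p)) (n∣m⇒m%n≡0 _ p (∣⇒∣ᵤ p∣a-b))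

  %ℕ≡0⇔≈0 : ∀ z → z ℤ.%ℕ p ≡ 0 ⇔ z ≈ 0ℤ
  %ℕ≡0⇔≈0 z = mk⇔
    (λ z%p≡0 → ≈-trans (≈-sym (%ℕ-≈ z)) (≈-reflexive (cong +_ z%p≡0)))
    (λ z≈0 → ≈-unique (n%ℕd<d z p) (ℕ.>-nonZero⁻¹ p) (≈-trans (%ℕ-≈ z) z≈0))

  ι : Fin p → ℤ
  ι a = + toℕ a

  -- Opaque, so that the argument of reduce can be recovered by unification.
  opaque
    reduce : ℤ → Fin p
    reduce z = fromℕ< (n%ℕd<d z p)

    ι-reduce : ∀ z → ι (reduce z) ≈ z
    ι-reduce z = subst (_≈ z) (cong +_ (sym (Fin.toℕ-fromℕ< (n%ℕd<d z p)))) (%ℕ-≈ z)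

  ι-injective : ∀ {a b} → ι a ≈ ι b → a ≡ b
  ι-injective a≈b = Fin.toℕ-injective (≈-unique (Fin.toℕ<n _) (Fin.toℕ<n _) a≈b)

  reduce-ι : ∀ a → reduce (ι a) ≡ a
  reduce-ι a = ι-injective (ι-reduce (ι a))

  reduce-cong : ∀ {x y} → x ≈ y → reduce x ≡ reduce y
  reduce-cong {x} {y} x≈y = ι-injective (≈-trans (ι-reduce x) (≈-trans x≈y (≈-sym (ι-reduce y))))

  ι-≈⇔≡ : ∀ {a w e} → ι w ≈ e → ι a ≈ e ⇔ a ≡ w
  ι-≈⇔≡ ιw≈e = mk⇔ (λ ιa≈e → ι-injective (≈-trans ιa≈e (≈-sym ιw≈e))) (λ { refl → ιw≈e })

  %ℕ≡0⇔≡ : ∀ {z e} a {w} → (z ≈ 0ℤ ⇔ ι a ≈ e) → ι w ≈ e → z ℤ.%ℕ p ≡ 0 ⇔ a ≡ w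
  %ℕ≡0⇔≡ a z≈0⇔ιa≈e ιw≈e = ι-≈⇔≡ ιw≈e ⇔-∘ (z≈0⇔ιa≈e ⇔-∘ %ℕ≡0⇔≈0 _)

  infixl 6 _+ₚ_
  infix  8 -ₚ_

  _+ₚ_ : Op₂ (Fin p)
  a +ₚ b = reduce (ι a ℤ.+ ι b)

  -ₚ_ : Op₁ (Fin p)
  -ₚ a = reduce (ℤ.- ι a)

  0ₚ : Fin p
  0ₚ = reduce 0ℤ

  +ₚ-assoc : ∀ a b c → (a +ₚ b) +ₚ c ≡ a +ₚ (b +ₚ c)
  +ₚ-assoc a b c = begin
    reduce (ι (a +ₚ b) ℤ.+ ι c)      ≡⟨ reduce-cong (+-cong (ι-reduce _) (≈-refl {ι c})) ⟩
    reduce (ι a ℤ.+ ι b ℤ.+ ι c)     ≡⟨ cong reduce (ℤ.+-assoc (ι a) (ι b) (ι c)) ⟩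
    reduce (ι a ℤ.+ (ι b ℤ.+ ι c))   ≡⟨ reduce-cong (+-cong (≈-refl {ι a}) (ι-reduce _)) ⟨
    reduce (ι a ℤ.+ ι (b +ₚ c))      ∎

  +ₚ-comm : ∀ a b → a +ₚ b ≡ b +ₚ a
  +ₚ-comm a b = cong reduce (ℤ.+-comm (ι a) (ι b))

  +ₚ-identityˡ : ∀ a → 0ₚ +ₚ a ≡ a
  +ₚ-identityˡ a = begin
    reduce (ι 0ₚ ℤ.+ ι a)   ≡⟨ reduce-cong (+-cong (ι-reduce 0ℤ) (≈-refl {ι a})) ⟩
    reduce (0ℤ ℤ.+ ι a)     ≡⟨ cong reduce (ℤ.+-identityˡ (ι a)) ⟩
    reduce (ι a)            ≡⟨ reduce-ι a ⟩
    a                       ∎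

  +ₚ-inverseˡ : ∀ a → -ₚ a +ₚ a ≡ 0ₚ
  +ₚ-inverseˡ a = begin
    reduce (ι (-ₚ a) ℤ.+ ι a)     ≡⟨ reduce-cong (+-cong (ι-reduce _) (≈-refl {ι a})) ⟩
    reduce (ℤ.- ι a ℤ.+ ι a)      ≡⟨ cong reduce (ℤ.+-inverseˡ (ι a)) ⟩
    0ₚ                            ∎

  +ₚ-isAbelianGroup : IsAbelianGroup _≡_ _+ₚ_ 0ₚ -ₚ_
  +ₚ-isAbelianGroup = record
    { isGroup = record
      { isMonoid = record
        { isSemigroup = record
          { isMagma = record { isEquivalence = isEquivalence ; ∙-cong = cong₂ _+ₚ_ }
          ; assoc = +ₚ-assoc
          }
        ; identity = +ₚ-identityˡ , λ a → trans (+ₚ-comm a 0ₚ) (+ₚ-identityˡ a)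
        }
      ; inverse = +ₚ-inverseˡ , λ a → trans (+ₚ-comm a (-ₚ a)) (+ₚ-inverseˡ a)
      ; ⁻¹-cong = cong -ₚ_
      }
    ; comm = +ₚ-comm
    }

module _ {A : Set} {_∙_ : Op₂ A} {ε : A} {_⁻¹ : Op₁ A}
         (isAbelianGroup : IsAbelianGroup _≡_ _∙_ ε _⁻¹) where

  open IsAbelianGroup isAbelianGroup using (assoc; identityˡ; identityʳ; inverseˡ; inverseʳ; comm)

  zipWith-isAbelianGroup : ∀ n →
    IsAbelianGroup _≡_ (Vec.zipWith {n = n} _∙_) (Vec.replicate n ε) (Vec.map _⁻¹)
  zipWith-isAbelianGroup n = record
    { isGroup = record
      { isMonoid = record
        { isSemigroup = record
          { isMagma = record { isEquivalence = isEquivalence ; ∙-cong = cong₂ (Vec.zipWith _∙_) }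
          ; assoc = Vec.zipWith-assoc assoc
          }
        ; identity = Vec.zipWith-identityˡ identityˡ , Vec.zipWith-identityʳ identityʳ
        }
      ; inverse = Vec.zipWith-inverseˡ inverseˡ , Vec.zipWith-inverseʳ inverseʳ
      ; ⁻¹-cong = cong (Vec.map _⁻¹)
      }
    ; comm = Vec.zipWith-comm comm
    }

-- The system Φ over 𝔽ₚⁿ

open +-*-Solver using (Polynomial; con; _:+_; _:*_; _:-_; :-_; _:=_; solve)

-- The solver's image of lincomb: ⟦ linear-form r zs ⟧ unfolds to lincomb r ⟦ zs ⟧.
linear-form : ∀ {k m} → Vec ℤ k → Vec (Polynomial m) k → Polynomial m
linear-form []       []       = con 0ℤ
linear-form (c ∷ cs) (z ∷ zs) = con c :* z :+ linear-form cs zs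

Φ₁ Φ₂ : Vec ℤ 9
Φ₁ = Vec.head Φ
Φ₂ = Vec.head (Vec.tail Φ)

Φ₁-value : ∀ z₁ z₂ z₃ z₄ z₅ z₆ z₇ z₈ z₉ →
  lincomb Φ₁ (z₁ ∷ z₂ ∷ z₃ ∷ z₄ ∷ z₅ ∷ z₆ ∷ z₇ ∷ z₈ ∷ z₉ ∷ []) ≡ z₁ ℤ.- z₂ ℤ.+ z₃ ℤ.- z₄
Φ₁-value = solve 9 (λ z₁ z₂ z₃ z₄ z₅ z₆ z₇ z₈ z₉ →
  linear-form Φ₁ (z₁ ∷ z₂ ∷ z₃ ∷ z₄ ∷ z₅ ∷ z₆ ∷ z₇ ∷ z₈ ∷ z₉ ∷ []) := z₁ :- z₂ :+ z₃ :- z₄) refl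

Φ₂-value : ∀ z₁ z₂ z₃ z₄ z₅ z₆ z₇ z₈ z₉ →
  lincomb Φ₂ (z₁ ∷ z₂ ∷ z₃ ∷ z₄ ∷ z₅ ∷ z₆ ∷ z₇ ∷ z₈ ∷ z₉ ∷ []) ≡ z₉ ℤ.- (ℤ.- z₅ ℤ.+ z₆ ℤ.- z₇ ℤ.+ z₈)
Φ₂-value = solve 9 (λ z₁ z₂ z₃ z₄ z₅ z₆ z₇ z₈ z₉ →
  linear-form Φ₂ (z₁ ∷ z₂ ∷ z₃ ∷ z₄ ∷ z₅ ∷ z₆ ∷ z₇ ∷ z₈ ∷ z₉ ∷ []) := z₉ :- (:- z₅ :+ z₆ :- z₇ :+ z₈)) refl

All-allFin⇔≡ : ∀ {A : Set} {n} {R : Fin n → Set} {a b : Vec A n} →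
               (∀ j → R j ⇔ lookup a j ≡ lookup b j) → All R (Vec.allFin n) ⇔ a ≡ b
All-allFin⇔≡ {a = a} {b} R⇔ = mk⇔
  (λ all-R → trans (sym (Vec.tabulate∘lookup a))
    (trans (Vec.tabulate-cong λ j → Equivalence.to (R⇔ j) (tabulate⁻ all-R j)) (Vec.tabulate∘lookup b)))
  (λ { refl → tabulate⁺ λ j → Equivalence.from (R⇔ j) refl })

module Fₚⁿ (p : ℕ) .{{_ : NonZero p}} (n : ℕ) where

  open ℤMod p

  V : Set
  V = Vec (Fin p) n

  L : List V
  L = Fpn p n

  Fₚⁿ-isAbelianGroup : IsAbelianGroup _≡_ (Vec.zipWith _+ₚ_) (Vec.replicate n 0ₚ) (Vec.map -ₚ_)
  Fₚⁿ-isAbelianGroup = zipWith-isAbelianGroup +ₚ-isAbelianGroup n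

  Fₚⁿ-abelianGroup : AbelianGroup 0ℓ 0ℓ
  Fₚⁿ-abelianGroup = record { isAbelianGroup = Fₚⁿ-isAbelianGroup }

  open AbelianGroup Fₚⁿ-abelianGroup using (_∙_; _⁻¹; ε)

  infix 4 _≟ⁿ_
  _≟ⁿ_ : DecidableEquality V
  _≟ⁿ_ = Vec.≡-dec Fin._≟_

  ∑-translate : ∀ t (F : V → ℚ) → ∑[ x ∈ L ] F (t ∙ x) ≡ ∑ L F
  ∑-translate =
    ∑-allVecs-translate (allFin p) _+ₚ_ (∑-allFin-translate (IsAbelianGroup.isGroup +ₚ-isAbelianGroup))

  ∑-δ : ∀ t (F : V → ℚ) → ∑[ x ∈ L ] (𝟙 (x ≟ⁿ t) * F x) ≡ F t
  ∑-δ = ∑-allVecs-δ (allFin p) Fin._≟_ ∑-allFin-δ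

  instance
    |L|-positive : Positive (∑[ _ ∈ L ] 1ℚ)
    |L|-positive = positive (ℚ.<-≤-trans (ℚ.positive⁻¹ 1ℚ) 1≤|L|)
      where
      𝟙*1≤1 : ∀ {P : Set} (P? : Dec P) → 𝟙 P? * 1ℚ ≤ 1ℚ
      𝟙*1≤1 P? with does P?
      ... | true  = ℚ.≤-refl
      ... | false = ℚ.nonNegative⁻¹ 1ℚ

      1≤|L| : 1ℚ ≤ ∑[ _ ∈ L ] 1ℚ
      1≤|L| = subst (_≤ ∑[ _ ∈ L ] 1ℚ) (∑-δ ε (λ _ → 1ℚ)) (∑-mono-≤ L λ x → 𝟙*1≤1 (x ≟ⁿ ε))

  open UniformMean _∙_ L ∑-translate using (|xs|; |xs|≢0; 𝔼; isInvariantMean; nested-𝔼)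
  open InvariantMean Fₚⁿ-isAbelianGroup isInvariantMean public
    using (𝔼-cong; 𝔼-1; T₄; T₅; T₄T₅-complement-bound)

  SatisfiesRow : Vec ℤ 9 → Vec V 9 → Set
  SatisfiesRow r xs =
    All (λ j → lincomb r (Vec.map (λ x → + toℕ (lookup x j)) xs) ℤ.%ℕ p ≡ 0) (Vec.allFin n)

  satisfiesRow? : ∀ r xs → Dec (SatisfiesRow r xs)
  satisfiesRow? r xs =
    VAll.all? (λ j → lincomb r (Vec.map (λ x → + toℕ (lookup x j)) xs) ℤ.%ℕ p ℕ.≟ 0) (Vec.allFin n)

  lookup-∙ : ∀ x y j → lookup (x ∙ y) j ≡ lookup x j +ₚ lookup y j
  lookup-∙ x y j = Vec.lookup-zipWith _+ₚ_ j x y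

  lookup-⁻¹ : ∀ x j → lookup (x ⁻¹) j ≡ -ₚ lookup x j
  lookup-⁻¹ x j = Vec.lookup-map j -ₚ_ x

  Φ₁-coordinate : ∀ a₁ a₂ a₃ a₄ a₅ a₆ a₇ a₈ a₉ →
    lincomb Φ₁ (ι a₁ ∷ ι a₂ ∷ ι a₃ ∷ ι a₄ ∷ ι a₅ ∷ ι a₆ ∷ ι a₇ ∷ ι a₈ ∷ ι a₉ ∷ []) ℤ.%ℕ p ≡ 0 ⇔
    a₄ ≡ a₁ +ₚ -ₚ a₂ +ₚ a₃
  Φ₁-coordinate a₁ a₂ a₃ a₄ a₅ a₆ a₇ a₈ a₉ = %ℕ≡0⇔≡ a₄
    (subst (λ z → z ≈ 0ℤ ⇔ ι a₄ ≈ e)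
      (sym (Φ₁-value (ι a₁) (ι a₂) (ι a₃) (ι a₄) (ι a₅) (ι a₆) (ι a₇) (ι a₈) (ι a₉)))
      (≈-sym⇔ ⇔-∘ x-y≈0⇔x≈y))
    (≈-trans (ι-reduce _) (+-cong (≈-trans (ι-reduce _) (+-cong (≈-refl {ι a₁}) (ι-reduce _))) (≈-refl {ι a₃})))
    where
    e = ι a₁ ℤ.- ι a₂ ℤ.+ ι a₃

  Φ₂-coordinate : ∀ a₁ a₂ a₃ a₄ a₅ a₆ a₇ a₈ a₉ →
    lincomb Φ₂ (ι a₁ ∷ ι a₂ ∷ ι a₃ ∷ ι a₄ ∷ ι a₅ ∷ ι a₆ ∷ ι a₇ ∷ ι a₈ ∷ ι a₉ ∷ []) ℤ.%ℕ p ≡ 0 ⇔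
    a₉ ≡ -ₚ a₅ +ₚ a₆ +ₚ -ₚ a₇ +ₚ a₈
  Φ₂-coordinate a₁ a₂ a₃ a₄ a₅ a₆ a₇ a₈ a₉ = %ℕ≡0⇔≡ a₉
    (subst (λ z → z ≈ 0ℤ ⇔ ι a₉ ≈ e)
      (sym (Φ₂-value (ι a₁) (ι a₂) (ι a₃) (ι a₄) (ι a₅) (ι a₆) (ι a₇) (ι a₈) (ι a₉)))
      x-y≈0⇔x≈y)
    (≈-trans (ι-reduce _) (+-cong (≈-trans (ι-reduce _)
      (+-cong (≈-trans (ι-reduce _) (+-cong (ι-reduce _) (≈-refl {ι a₆}))) (ι-reduce _))) (≈-refl {ι a₈})))
    where
    e = ℤ.- ι a₅ ℤ.+ ι a₆ ℤ.- ι a₇ ℤ.+ ι a₈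

  Φ₁-row⇔ : ∀ x₁ x₂ x₃ x₄ x₅ x₆ x₇ x₈ x₉ →
            SatisfiesRow Φ₁ (x₁ ∷ x₂ ∷ x₃ ∷ x₄ ∷ x₅ ∷ x₆ ∷ x₇ ∷ x₈ ∷ x₉ ∷ []) ⇔ x₄ ≡ x₁ ∙ x₂ ⁻¹ ∙ x₃
  Φ₁-row⇔ x₁ x₂ x₃ x₄ x₅ x₆ x₇ x₈ x₉ = All-allFin⇔≡ λ j →
    mk⇔ (λ eq → trans eq (sym (lookup-w j))) (λ eq → trans eq (lookup-w j)) ⇔-∘
      (Φ₁-coordinate (lookup x₁ j) (lookup x₂ j) (lookup x₃ j) (lookup x₄ j) (lookup x₅ j)
                     (lookup x₆ j) (lookup x₇ j) (lookup x₈ j) (lookup x₉ j))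
    where
    lookup-w : ∀ j → lookup (x₁ ∙ x₂ ⁻¹ ∙ x₃) j ≡ lookup x₁ j +ₚ -ₚ lookup x₂ j +ₚ lookup x₃ j
    lookup-w j = trans (lookup-∙ (x₁ ∙ x₂ ⁻¹) x₃ j)
      (cong (_+ₚ lookup x₃ j) (trans (lookup-∙ x₁ (x₂ ⁻¹) j) (cong (lookup x₁ j +ₚ_) (lookup-⁻¹ x₂ j))))

  Φ₂-row⇔ : ∀ x₁ x₂ x₃ x₄ x₅ x₆ x₇ x₈ x₉ →
            SatisfiesRow Φ₂ (x₁ ∷ x₂ ∷ x₃ ∷ x₄ ∷ x₅ ∷ x₆ ∷ x₇ ∷ x₈ ∷ x₉ ∷ []) ⇔ x₉ ≡ x₅ ⁻¹ ∙ x₆ ∙ x₇ ⁻¹ ∙ x₈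
  Φ₂-row⇔ x₁ x₂ x₃ x₄ x₅ x₆ x₇ x₈ x₉ = All-allFin⇔≡ λ j →
    mk⇔ (λ eq → trans eq (sym (lookup-w j))) (λ eq → trans eq (lookup-w j)) ⇔-∘
      (Φ₂-coordinate (lookup x₁ j) (lookup x₂ j) (lookup x₃ j) (lookup x₄ j) (lookup x₅ j)
                     (lookup x₆ j) (lookup x₇ j) (lookup x₈ j) (lookup x₉ j))
    where
    lookup-w : ∀ j → lookup (x₅ ⁻¹ ∙ x₆ ∙ x₇ ⁻¹ ∙ x₈) j ≡
                     -ₚ lookup x₅ j +ₚ lookup x₆ j +ₚ -ₚ lookup x₇ j +ₚ lookup x₈ j
    lookup-w j = trans (lookup-∙ (x₅ ⁻¹ ∙ x₆ ∙ x₇ ⁻¹) x₈ j)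
      (cong (_+ₚ lookup x₈ j) (trans (lookup-∙ (x₅ ⁻¹ ∙ x₆) (x₇ ⁻¹) j)
        (cong₂ _+ₚ_ (trans (lookup-∙ (x₅ ⁻¹) x₆ j) (cong (_+ₚ lookup x₆ j) (lookup-⁻¹ x₅ j))) (lookup-⁻¹ x₇ j))))

  𝟙-isSolution : ∀ x₁ x₂ x₃ x₄ x₅ x₆ x₇ x₈ x₉ →
    𝟙 (isSolution p Φ (x₁ ∷ x₂ ∷ x₃ ∷ x₄ ∷ x₅ ∷ x₆ ∷ x₇ ∷ x₈ ∷ x₉ ∷ [])) ≡
    𝟙 (x₄ ≟ⁿ x₁ ∙ x₂ ⁻¹ ∙ x₃) * 𝟙 (x₉ ≟ⁿ x₅ ⁻¹ ∙ x₆ ∙ x₇ ⁻¹ ∙ x₈)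
  𝟙-isSolution x₁ x₂ x₃ x₄ x₅ x₆ x₇ x₈ x₉ = begin
    𝟙 (row₁? ×-dec (row₂? ×-dec no-rows?))
      ≡⟨ 𝟙-×-dec row₁? (row₂? ×-dec no-rows?) ⟩
    𝟙 row₁? * 𝟙 (row₂? ×-dec no-rows?)
      ≡⟨ cong (𝟙 row₁? *_) (trans (𝟙-×-dec row₂? no-rows?) (ℚ.*-identityʳ (𝟙 row₂?))) ⟩
    𝟙 row₁? * 𝟙 row₂?
      ≡⟨ cong₂ _*_ (𝟙-cong (Φ₁-row⇔ x₁ x₂ x₃ x₄ x₅ x₆ x₇ x₈ x₉) row₁? (x₄ ≟ⁿ x₁ ∙ x₂ ⁻¹ ∙ x₃))
                   (𝟙-cong (Φ₂-row⇔ x₁ x₂ x₃ x₄ x₅ x₆ x₇ x₈ x₉) row₂? (x₉ ≟ⁿ x₅ ⁻¹ ∙ x₆ ∙ x₇ ⁻¹ ∙ x₈)) ⟩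
    𝟙 (x₄ ≟ⁿ x₁ ∙ x₂ ⁻¹ ∙ x₃) * 𝟙 (x₉ ≟ⁿ x₅ ⁻¹ ∙ x₆ ∙ x₇ ⁻¹ ∙ x₈)
      ∎
    where
    xs = x₁ ∷ x₂ ∷ x₃ ∷ x₄ ∷ x₅ ∷ x₆ ∷ x₇ ∷ x₈ ∷ x₉ ∷ []
    row₁? = satisfiesRow? Φ₁ xs
    row₂? = satisfiesRow? Φ₂ xs
    no-rows? = VAll.all? (λ r → satisfiesRow? r xs) []

  T₄-summand : (V → ℚ) → Vec V 3 → ℚ
  T₄-summand f (a ∷ b ∷ c ∷ []) = f a * (f b * (f c * f (a ∙ b ⁻¹ ∙ c)))

  T₅-summand : (V → ℚ) → Vec V 4 → ℚ
  T₅-summand f (a ∷ b ∷ c ∷ d ∷ []) = f a * (f b * (f c * (f d * f (a ⁻¹ ∙ b ∙ c ⁻¹ ∙ d))))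

  Φ₁-summand : (V → ℚ) → Vec V 4 → ℚ
  Φ₁-summand f (a ∷ b ∷ c ∷ d ∷ []) = 𝟙 (d ≟ⁿ a ∙ b ⁻¹ ∙ c) * (f a * (f b * (f c * f d)))

  Φ₂-summand : (V → ℚ) → Vec V 5 → ℚ
  Φ₂-summand f (a ∷ b ∷ c ∷ d ∷ e ∷ []) = 𝟙 (e ≟ⁿ a ⁻¹ ∙ b ∙ c ⁻¹ ∙ d) * (f a * (f b * (f c * (f d * f e))))

  ∑-solutions : ∀ f → ∑[ xs ∈ solutions p n Φ ] prodVec (Vec.map f xs) ≡
                      nested (∑ L) 3 (T₄-summand f) * nested (∑ L) 4 (T₅-summand f)
  ∑-solutions f = begin
    ∑[ xs ∈ solutions p n Φ ] prodVec (Vec.map f xs)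
      ≡⟨ ∑-filter (allVecs L 9) (isSolution p Φ) _ ⟩
    ∑[ xs ∈ allVecs L 9 ] (𝟙 (isSolution p Φ xs) * prodVec (Vec.map f xs))
      ≡⟨ ∑-allVecs L 9 _ ⟩
    nested (∑ L) 4 (λ xs → nested (∑ L) 5 λ ys →
      𝟙 (isSolution p Φ (xs Vec.++ ys)) * prodVec (Vec.map f (xs Vec.++ ys)))
      ≡⟨ nested-cong (∑-cong L) 4 (λ xs → nested-cong (∑-cong L) 5 (separate xs)) ⟩
    nested (∑ L) 4 (λ xs → nested (∑ L) 5 λ ys → Φ₁-summand f xs * Φ₂-summand f ys)
      ≡⟨ nested-product (∑-cong L) (∑-*ˡ L) 4 5 (Φ₁-summand f) (Φ₂-summand f) ⟩
    nested (∑ L) 4 (Φ₁-summand f) * nested (∑ L) 5 (Φ₂-summand f)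
      ≡⟨ cong₂ _*_ (nested-cong (∑-cong L) 3 solve-x₄) (nested-cong (∑-cong L) 4 solve-x₉) ⟩
    nested (∑ L) 3 (T₄-summand f) * nested (∑ L) 4 (T₅-summand f)
      ∎
    where
    regroup : ∀ i₁ i₂ a b c d e g h k l →
      i₁ * i₂ * (a * (b * (c * (d * (e * (g * (h * (k * (l * 1ℚ))))))))) ≡
      i₁ * (a * (b * (c * d))) * (i₂ * (e * (g * (h * (k * l)))))
    regroup = solve-∀ ℚ-ring

    separate : ∀ xs ys → 𝟙 (isSolution p Φ (xs Vec.++ ys)) * prodVec (Vec.map f (xs Vec.++ ys)) ≡
                         Φ₁-summand f xs * Φ₂-summand f ys
    separate (x₁ ∷ x₂ ∷ x₃ ∷ x₄ ∷ []) (x₅ ∷ x₆ ∷ x₇ ∷ x₈ ∷ x₉ ∷ []) =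
      trans (cong (_* prodVec (Vec.map f (x₁ ∷ x₂ ∷ x₃ ∷ x₄ ∷ x₅ ∷ x₆ ∷ x₇ ∷ x₈ ∷ x₉ ∷ [])))
                  (𝟙-isSolution x₁ x₂ x₃ x₄ x₅ x₆ x₇ x₈ x₉))
            (regroup (𝟙 (x₄ ≟ⁿ x₁ ∙ x₂ ⁻¹ ∙ x₃)) (𝟙 (x₉ ≟ⁿ x₅ ⁻¹ ∙ x₆ ∙ x₇ ⁻¹ ∙ x₈))
                     (f x₁) (f x₂) (f x₃) (f x₄) (f x₅) (f x₆) (f x₇) (f x₈) (f x₉))

    solve-x₄ : ∀ v → ∑[ d ∈ L ] Φ₁-summand f (v Vec.++ d ∷ []) ≡ T₄-summand f v
    solve-x₄ (a ∷ b ∷ c ∷ []) = ∑-δ (a ∙ b ⁻¹ ∙ c) (λ d → f a * (f b * (f c * f d)))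

    solve-x₉ : ∀ v → ∑[ e ∈ L ] Φ₂-summand f (v Vec.++ e ∷ []) ≡ T₅-summand f v
    solve-x₉ (a ∷ b ∷ c ∷ d ∷ []) = ∑-δ (a ⁻¹ ∙ b ∙ c ⁻¹ ∙ d) (λ e → f a * (f b * (f c * (f d * f e))))

  prodVec-map-1 : ∀ {k} (xs : Vec V k) → prodVec (Vec.map (λ _ → 1ℚ) xs) ≡ 1ℚ
  prodVec-map-1 []       = refl
  prodVec-map-1 (x ∷ xs) = trans (cong (_*_ 1ℚ) (prodVec-map-1 xs)) (ℚ.*-identityˡ 1ℚ)

  T≡T₄*T₅ : ∀ f → T p n Φ f ≡ T₄ f * T₅ f
  T≡T₄*T₅ f = begin
    T p n Φ f
      ≡⟨ trans (cong (_*_ (T p n Φ f)) T₄T₅-one) (ℚ.*-identityʳ (T p n Φ f)) ⟨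
    T p n Φ f * (T₄ one * T₅ one)
      ≡⟨ cong₂ (λ s t → T p n Φ f * (s * t)) (scale₃ one) (scale₄ one) ⟩
    T p n Φ f * (c ^ 3 * S₃ one * (c ^ 4 * S₄ one))
      ≡⟨ regroup (T p n Φ f) (c ^ 3) (c ^ 4) (S₃ one) (S₄ one) ⟩
    T p n Φ f * (S₃ one * S₄ one) * (c ^ 3 * c ^ 4)
      ≡⟨ cong (λ N → T p n Φ f * N * (c ^ 3 * c ^ 4)) count ⟨
    T p n Φ f * ∑[ _ ∈ sols ] 1ℚ * (c ^ 3 * c ^ 4)
      ≡⟨ cong (_* (c ^ 3 * c ^ 4)) (mean-map (λ xs → prodVec (Vec.map f xs)) sols) ⟩
    ∑[ xs ∈ sols ] prodVec (Vec.map f xs) * (c ^ 3 * c ^ 4)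
      ≡⟨ cong (_* (c ^ 3 * c ^ 4)) (∑-solutions f) ⟩
    S₃ f * S₄ f * (c ^ 3 * c ^ 4)
      ≡⟨ interchange (S₃ f) (S₄ f) (c ^ 3) (c ^ 4) ⟩
    c ^ 3 * S₃ f * (c ^ 4 * S₄ f)
      ≡⟨ cong₂ _*_ (scale₃ f) (scale₄ f) ⟨
    T₄ f * T₅ f
      ∎
    where
    sols = solutions p n Φ
    c = 1/ |xs|

    one : V → ℚ
    one _ = 1ℚ

    S₃ : (V → ℚ) → ℚ
    S₃ u = nested (∑ L) 3 (T₄-summand u)

    S₄ : (V → ℚ) → ℚ
    S₄ u = nested (∑ L) 4 (T₅-summand u)

    scale₃ : ∀ u → T₄ u ≡ c ^ 3 * S₃ u
    scale₃ u = nested-𝔼 3 (T₄-summand u)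

    scale₄ : ∀ u → T₅ u ≡ c ^ 4 * S₄ u
    scale₄ u = nested-𝔼 4 (T₅-summand u)

    T₄T₅-one : T₄ one * T₅ one ≡ 1ℚ
    T₄T₅-one = cong₂ _*_ (nested-1 𝔼-cong 𝔼-1 3) (nested-1 𝔼-cong 𝔼-1 4)

    count : ∑[ _ ∈ sols ] 1ℚ ≡ S₃ one * S₄ one
    count = trans (∑-cong sols λ xs → sym (prodVec-map-1 xs)) (∑-solutions one)

    regroup : ∀ t a b x y → t * (a * x * (b * y)) ≡ t * (x * y) * (a * b)
    regroup = solve-∀ ℚ-ring

    interchange : ∀ x y a b → x * y * (a * b) ≡ a * x * (b * y)
    interchange = solve-∀ ℚ-ring

lemma3p1 : (p : ℕ) .{{_ : NonZero p}} → Prime p → p ≢ 2 →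
    (n : ℕ) → n ≥ 1 →
    (f : Vec (Fin p) n → ℚ) → (∀ x → (0ℚ ≤ f x) × (f x ≤ 1ℚ)) →
    (+ 1) / 256 ≤ T p n Φ f Data.Rational.+ T p n Φ (λ x → 1ℚ - f x)
lemma3p1 p _ _ n _ f 0≤f≤1 =
  subst ((+ 1) / 256 ≤_) (sym (cong₂ _+_ (T≡T₄*T₅ f) (T≡T₄*T₅ (λ x → 1ℚ - f x))))
    (T₄T₅-complement-bound f 0≤f≤1)
  where
  open Fₚⁿ p n
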